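{- For every prime $p\geq 3$ and every integer $k\in[3,p]$, there exists a cyclically $k$-diagonal globally simple $\mathrm{H}_p(p;k)$, i.e. such a Heffter array over $\mathbb{Z}_{p(2k+1)}$ relative to its subgroup of order $p$.
   Context: Let $w=2nk+t$ and let $J$ be the subgroup of $\mathbb{Z}_w$ of order $t$. A half-set of $\mathbb{Z}_w\setminus J$ is a subset $V$ of size $nk$ with $V\cup(-V)=\mathbb{Z}_w\setminus J$. An $\mathrm{H}_t(n;k)$ Heffter array over $\mathbb{Z}_w$ relative to $J$ is an $n\times n$ partially filled array with entries in $\mathbb{Z}_w$ such that each row and each column has exactly $k$ filled cells, the entries form a half-set of $\mathbb{Z}_w\setminus J$, and every row and column sums to $0$ in $\mathbb{Z}_w$. A sequence $(b_0,\dots,b_{k-1})$ is a simple ordering if its partial sums $c_i=\sum_{j=0}^{i}b_j$ are pairwise distinct. The array is globally simple if each row read left to right and each column read top to bottom gives a simple ordering of its entries. For an $n\times n$ array and $i\in[1,n]$, the $i$-th diagonal is $D_i=\{(i,1),(i+1,2),\dots,(i-1,n)\}$, with row and column indices taken modulo $n$ in $\{1,\dots,n\}$; diagonals $D_i,D_{i+1},\dots,D_{i+r}$ are consecutive. The array is cyclically $k$-diagonal if its nonempty cells are exactly those of $k$ consecutive diagonals. -}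

module Defs where

open import Data.Nat using (ℕ; zero; suc; _+_; _*_; _∸_; _<_; _≤_)
open import Data.Nat.DivMod using (_%_)
open import Data.Fin using (Fin; toℕ)
open import Data.Maybe using (Maybe; just; nothing; is-just)
open import Data.List using (List; []; _∷_; map; concatMap; length; filter; catMaybes; allFin)
open import Data.List.Relation.Unary.Unique.Propositional using (Unique)
open import Data.List.Membership.Propositional using (_∈_)
open import Data.Product using (Σ; ∃; _×_; _,_)
open import Data.Sum using (_⊎_)
open import Data.Bool using (Bool; true; false)
open import Relation.Binary.PropositionalEquality using (_≡_)
open import Function.Bundles using (_⇔_)

-- Residues of ℤ_w are represented by natural numbers < w; 'mod w x' is x mod w
-- (for w = 0 it is unused; every w below is positive).
mod : ℕ → ℕ → ℕ
mod zero    x = x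
mod (suc w) x = x % suc w

neg : ℕ → ℕ → ℕ
neg w x = mod w (w ∸ mod w x)

-- An n×n partially filled array with entries in ℤ_w (entries as naturals;
-- a well-formed array has all entries < w, required below).
Array : ℕ → Set
Array n = Fin n → Fin n → Maybe ℕ

rowList : ∀ {n} → Array n → Fin n → List ℕ
rowList {n} A i = catMaybes (map (λ j → A i j) (allFin n))

colList : ∀ {n} → Array n → Fin n → List ℕ
colList {n} A j = catMaybes (map (λ i → A i j) (allFin n))

entries : ∀ {n} → Array n → List ℕ
entries {n} A = concatMap (rowList A) (allFin n)

sumMod : ℕ → List ℕ → ℕ
sumMod w []       = 0
sumMod w (x ∷ xs) = mod w (x + sumMod w xs)

partialSums : ℕ → ℕ → List ℕ → List ℕ
partialSums w acc []       = []
partialSums w acc (x ∷ xs) = mod w (acc + x) ∷ partialSums w (mod w (acc + x)) xs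

SimpleOrdering : ℕ → List ℕ → Set
SimpleOrdering w xs = Unique (partialSums w 0 xs)

-- x ∈ J, where J is the subgroup of ℤ_w of order t (t ∣ w):
-- J = { x ∈ ℤ_w : t·x = 0 }
InJ : ℕ → ℕ → ℕ → Set
InJ w t x = mod w (t * x) ≡ 0

HalfSet : ℕ → ℕ → ℕ → List ℕ → Set
HalfSet w t m V =
  Unique V × length V ≡ m ×
  (∀ x → x ∈ V → x < w × (InJ w t x → Data.Empty.⊥)) ×
  (∀ x → x < w → (InJ w t x → Data.Empty.⊥) → x ∈ V ⊎ neg w x ∈ V)
  where import Data.Empty

countFilled : List (Maybe ℕ) → ℕ
countFilled xs = length (catMaybes xs)

HeffterW : ℕ → ℕ → ℕ → ℕ
HeffterW n k t = 2 * n * k + t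

IsHeffter : (n k t : ℕ) → Array n → Set
IsHeffter n k t A =
  (∀ i → length (rowList A i) ≡ k) ×
  (∀ j → length (colList A j) ≡ k) ×
  HalfSet w t (n * k) (entries A) ×
  (∀ i → sumMod w (rowList A i) ≡ 0) ×
  (∀ j → sumMod w (colList A j) ≡ 0)
  where w = HeffterW n k t

GloballySimple : (w : ℕ) → ∀ {n} → Array n → Set
GloballySimple w {n} A =
  (∀ i → SimpleOrdering w (rowList A i)) ×
  (∀ j → SimpleOrdering w (colList A j))

-- Cell (r,c) (0-indexed) lies on the diagonal with 0-indexed shift d iff
-- r - c ≡ d (mod n); the paper's D_i has shift d = i - 1.
-- Cyclically k-diagonal: ∃ d such that the nonempty cells are exactly those on
-- the k consecutive diagonals with shifts d, d+1, ..., d+k-1 (mod n).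
OnDiagonals : (n k : ℕ) → Fin n → Fin n → Fin n → Set
OnDiagonals n k d r c =
  Σ ℕ λ j → j < k × mod n (toℕ r + (n ∸ toℕ c)) ≡ mod n (toℕ d + j)

CyclicallyKDiagonal : (n k : ℕ) → Array n → Set
CyclicallyKDiagonal n k A =
  Σ (Fin n) λ d → ∀ r c → (is-just (A r c) ≡ true) ⇔ OnDiagonals n k d r c

-- Write m = 2k + 1 and w = p m, so that J = m ℤ_w and every x ∈ ℤ_w ∖ J is uniquely
-- ρ + m q with ρ ∈ ℤ_m ∖ {0} and q ∈ ℤ_p. The cell of row r on the diagonal D < k
-- (the cells with r − c ≡ D mod p) holds γ_D + m ((a_D r + t_D) mod p), where
--
-- * γ_0, …, γ_{k-1} lists one element of each pair {±x} of ℤ_m ∖ {0}, sums to 0, and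
--   has pairwise distinct partial sums: an alternating sequence 1, −2, 3, −4, … that
--   skips one even magnitude v and closes with ±v;
-- * the multipliers a = (μ, 2, …, 2, μ) with μ = p − (k − 2) are units mod p with
--   ∑ a_D ≡ ∑ a_D D ≡ 0, and the offsets satisfy ∑ t_D ≡ −(∑ γ_D)/m (mod p).
--
-- A row meets the diagonals in cyclically descending order, a column in cyclically
-- ascending order, so modulo m both read a rotation of γ or of its reverse; a rotation
-- of a zero-sum sequence with distinct partial sums again has distinct partial sums,
-- which makes the array globally simple. Modulo m the diagonal D is constantly γ_D,
-- while its quotients a_D r + t_D run through all of ℤ_p; since the γ_D cover ℤ_m ∖ {0}
-- up to sign, the entries form a half-set of ℤ_w ∖ J. Finally every row or column sum
-- is ∑ γ_D + m U with U ≡ ∑ t_D (mod p), thanks to ∑ a_D ≡ ∑ a_D D ≡ 0, and this is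
-- divisible by w because ∑ γ_D = N m with p ∣ N + ∑ t_D.
module Submission where

open import Defs
open import Data.Nat using (ℕ; _≤_; _*_; _+_)
open import Data.Nat.Primality using (Prime)
open import Data.Product using (Σ; _×_)

open import Data.Bool using (true; false; if_then_else_)
open import Data.Empty using (⊥; ⊥-elim)
open import Data.Fin using (Fin; toℕ; fromℕ<)
open import Data.Fin.Properties using (toℕ<n; toℕ-fromℕ<; toℕ-injective)
open import Data.List
  using (List; []; _∷_; _++_; map; reverse; upTo; downFrom; applyUpTo; applyDownFrom;
         tabulate; allFin; catMaybes; concat; length)
open import Data.List.Membership.Propositional using (_∈_)
open import Data.List.Membership.Propositional.Properties
  using (∈-upTo⁻; ∈-downFrom⁻; ∈-downFrom⁺; ∈-map⁺; ∈-map⁻; ∈-concat⁺′; ∈-concat⁻′;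
         ∈-allFin)
open import Data.List.Properties
  using (map-++; map-∘; map-cong; map-cong-local; map-id; map-upTo; map-downFrom;
         map-applyUpTo; map-tabulate; reverse-upTo; reverse-map; reverse-++; upTo-∷ʳ;
         catMaybes-++; ++-identityʳ; length-++; length-map; length-upTo; length-downFrom;
         length-tabulate; ∷-injectiveˡ; ∷-injectiveʳ)
open import Data.List.Relation.Binary.Disjoint.Propositional using (Disjoint)
open import Data.List.Relation.Binary.Permutation.Propositional using (_↭_; ↭-refl; ↭-sym; ↭⇒↭ₛ)
open import Data.List.Relation.Binary.Permutation.Propositional.Properties
  using (++-comm; ++⁺; ↭-reverse; ↭-length; ∈-resp-↭)
open import Data.List.Relation.Unary.All as All using (All; []; _∷_)
import Data.List.Relation.Unary.All.Properties as All
open import Data.List.Relation.Unary.AllPairs as AllPairs using ([]; _∷_)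
import Data.List.Relation.Unary.AllPairs.Properties as AllPairs
open import Data.List.Relation.Unary.Any using (here; there)
open import Data.List.Relation.Unary.Unique.Propositional using (Unique)
import Data.List.Relation.Unary.Unique.Propositional.Properties as Unique
open import Data.Maybe using (Maybe; just; nothing; is-just)
open import Data.Nat
  using (zero; suc; pred; _∸_; _<_; _≟_; _≤?_; _<?_; z≤n; s≤s; NonZero; >-nonZero; >-nonZero⁻¹)
open import Data.Nat.Coprimality using (coprime-Bézout; prime⇒coprime)
open import Data.Nat.DivMod
open import Data.Nat.Divisibility
  using (_∣_; divides; m%n≡0⇒n∣m; n∣m⇒m%n≡0; *-cancelˡ-∣; *-monoʳ-∣; n∣m*n)
open import Data.Nat.GCD using (module Bézout)
open import Data.Nat.ListAction using (sum)
open import Data.Nat.ListAction.Properties using (sum-++; sum-↭)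
open import Data.Nat.Primality using (prime⇒nonZero)
open import Data.Nat.Properties
open import Algebra.Properties.CommutativeSemigroup +-commutativeSemigroup
  using () renaming (interchange to +-interchange)
open import Data.Nat.Tactic.RingSolver using (solve-∀)
open import Data.Product using (_,_; proj₁; proj₂; ∃-syntax)
open import Data.Sum using (_⊎_; inj₁; inj₂; [_,_]′)
open import Function using (_∘_)
open import Function.Bundles using (mk⇔)
open import Relation.Binary using (Setoid; tri<; tri≈; tri>)
open import Relation.Binary.PropositionalEquality
open import Data.List.Relation.Binary.Permutation.Setoid.Properties (setoid ℕ)
  using (Unique-resp-↭)
open import Relation.Nullary using (¬_; Dec; yes; no; does)
open import Relation.Nullary.Decidable using (dec-true; dec-false)

∑< : ℕ → (ℕ → ℕ) → ℕ
∑< n f = sum (map f (downFrom n))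

∑<-cong : ∀ n {f g} → (∀ {i} → i < n → f i ≡ g i) → ∑< n f ≡ ∑< n g
∑<-cong zero    f≗g = refl
∑<-cong (suc n) f≗g = cong₂ _+_ (f≗g ≤-refl) (∑<-cong n (f≗g ∘ m≤n⇒m≤1+n))

∑<-+ : ∀ n f g → ∑< n (λ i → f i + g i) ≡ ∑< n f + ∑< n g
∑<-+ zero    f g = refl
∑<-+ (suc n) f g =
  trans (cong (f n + g n +_) (∑<-+ n f g)) (+-interchange (f n) (g n) (∑< n f) (∑< n g))

∑<-*ˡ : ∀ n c f → ∑< n (λ i → c * f i) ≡ c * ∑< n f
∑<-*ˡ zero    c f = sym (*-zeroʳ c)
∑<-*ˡ (suc n) c f = trans (cong (c * f n +_) (∑<-*ˡ n c f)) (sym (*-distribˡ-+ c (f n) (∑< n f)))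

∑<-mono-≤ : ∀ f {i j} → i ≤ j → ∑< i f ≤ ∑< j f
∑<-mono-≤ f {j = zero}  z≤n = ≤-refl
∑<-mono-≤ f {i} {suc j} i≤1+j with m≤n⇒m<n∨m≡n i≤1+j
... | inj₁ (s≤s i≤j) = ≤-trans (∑<-mono-≤ f i≤j) (m≤n+m (∑< j f) (f j))
... | inj₂ refl      = ≤-refl

sum-map-upTo : ∀ n f → sum (map f (upTo n)) ≡ ∑< n f
sum-map-upTo n f = begin
  sum (map f (upTo n))             ≡⟨ sum-↭ (↭-reverse (map f (upTo n))) ⟨
  sum (reverse (map f (upTo n)))   ≡⟨ cong sum (reverse-map f (upTo n)) ⟨
  sum (map f (reverse (upTo n)))   ≡⟨ cong (sum ∘ map f) (reverse-upTo n) ⟩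
  ∑< n f                           ∎
  where open ≡-Reasoning

module Modulo (n : ℕ) .{{_ : NonZero n}} where

  infix 4 _≈_
  _≈_ : ℕ → ℕ → Set
  x ≈ y = x % n ≡ y % n

  ≈-setoid : Setoid _ _
  ≈-setoid = record
    { Carrier = ℕ ; _≈_ = _≈_
    ; isEquivalence = record { refl = refl ; sym = sym ; trans = trans } }

  x%n≈x : ∀ x → x % n ≈ x
  x%n≈x x = m%n%n≡m%n x n

  +-cong : ∀ {a b c d} → a ≈ b → c ≈ d → a + c ≈ b + d
  +-cong {a} {b} {c} {d} a≈b c≈d = begin
    (a + c) % n             ≡⟨ %-distribˡ-+ a c n ⟩
    (a % n + c % n) % n     ≡⟨ cong₂ (λ x y → (x + y) % n) a≈b c≈d ⟩
    (b % n + d % n) % n     ≡⟨ %-distribˡ-+ b d n ⟨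
    (b + d) % n             ∎
    where open ≡-Reasoning

  *-cong : ∀ {a b c d} → a ≈ b → c ≈ d → a * c ≈ b * d
  *-cong {a} {b} {c} {d} a≈b c≈d = begin
    (a * c) % n             ≡⟨ %-distribˡ-* a c n ⟩
    (a % n * (c % n)) % n   ≡⟨ cong₂ (λ x y → (x * y) % n) a≈b c≈d ⟩
    (b % n * (d % n)) % n   ≡⟨ %-distribˡ-* b d n ⟨
    (b * d) % n             ∎
    where open ≡-Reasoning

  x%n+y≈x+y : ∀ x y → x % n + y ≈ x + y
  x%n+y≈x+y x y = +-cong {x % n} {x} {y} {y} (x%n≈x x) refl

  0%n≡0 : 0 % n ≡ 0
  0%n≡0 = m<n⇒m%n≡m (>-nonZero⁻¹ n)

  x*n≈0 : ∀ x → x * n ≈ 0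
  x*n≈0 x = trans (m*n%n≡0 x n) (sym 0%n≡0)

  negate : ℕ → ℕ
  negate x = n ∸ x % n

  negate-inverseˡ : ∀ x → negate x + x ≈ 0
  negate-inverseˡ x = begin
    (negate x + x) % n      ≡⟨ +-cong {negate x} refl (x%n≈x x) ⟨
    (n ∸ x % n + x % n) % n ≡⟨ cong (_% n) (m∸n+n≡m (<⇒≤ (m%n<n x n))) ⟩
    n % n                   ≡⟨ trans (n%n≡0 n) (sym 0%n≡0) ⟩
    0 % n                   ∎
    where open ≡-Reasoning

  +-cancelˡ : ∀ a {x y} → a + x ≈ a + y → x ≈ y
  +-cancelˡ a {x} {y} a+x≈a+y = begin
    x                       ≈⟨ +-cong (negate-inverseˡ a) refl ⟨
    negate a + a + x        ≡⟨ +-assoc (negate a) a x ⟩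
    negate a + (a + x)      ≈⟨ +-cong {negate a} refl a+x≈a+y ⟩
    negate a + (a + y)      ≡⟨ +-assoc (negate a) a y ⟨
    negate a + a + y        ≈⟨ +-cong (negate-inverseˡ a) refl ⟩
    y                       ∎
    where open import Relation.Binary.Reasoning.Setoid ≈-setoid

  private
    ≉-close : ∀ {x y} → x < y → y < x + n → ¬ x ≈ y
    ≉-close {x} {y} x<y y<x+n x≈y = <⇒≢ (m<n⇒0<n∸m x<y) (sym y∸x≡0)
      where
      y∸x≈0 : y ∸ x ≈ 0
      y∸x≈0 = +-cancelˡ x (begin
        (x + (y ∸ x)) % n   ≡⟨ cong (_% n) (m+[n∸m]≡n (<⇒≤ x<y)) ⟩
        y % n               ≡⟨ x≈y ⟨
        x % n               ≡⟨ cong (_% n) (+-identityʳ x) ⟨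
        (x + 0) % n         ∎)
        where open ≡-Reasoning
      y∸x≡0 : y ∸ x ≡ 0
      y∸x≡0 = trans (sym (m<n⇒m%n≡m (m<n+o⇒m∸n<o y x y<x+n))) (trans y∸x≈0 0%n≡0)

  ≈-window⇒≡ : ∀ {L x y} → L ≤ x → x < L + n → L ≤ y → y < L + n → x ≈ y → x ≡ y
  ≈-window⇒≡ {L} {x} {y} L≤x x<L+n L≤y y<L+n x≈y with <-cmp x y
  ... | tri≈ _ x≡y _ = x≡y
  ... | tri< x<y _ _ = ⊥-elim (≉-close x<y (<-≤-trans y<L+n (+-monoˡ-≤ n L≤x)) x≈y)
  ... | tri> _ _ y<x = ⊥-elim (≉-close y<x (<-≤-trans x<L+n (+-monoˡ-≤ n L≤y)) (sym x≈y))

  ∑<-cong-≈ : ∀ l {f g} → (∀ {i} → i < l → f i ≈ g i) → ∑< l f ≈ ∑< l g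
  ∑<-cong-≈ zero    f≈g = refl
  ∑<-cong-≈ (suc l) {f} {g} f≈g =
    +-cong {f l} {g l} {∑< l f} {∑< l g} (f≈g ≤-refl) (∑<-cong-≈ l (f≈g ∘ m≤n⇒m≤1+n))

mod≡% : ∀ w .{{_ : NonZero w}} x → mod w x ≡ x % w
mod≡% (suc w) x = refl

Rotation : {A : Set} → List A → List A → Set
Rotation xs ys = ∃[ front ] ∃[ back ] xs ≡ front ++ back × ys ≡ back ++ front

module _ {A : Set} where

  Rotation⇒↭ : {xs ys : List A} → Rotation xs ys → xs ↭ ys
  Rotation⇒↭ (front , back , refl , refl) = ++-comm front back

  Rotation-reverse : {xs ys : List A} → Rotation xs ys → Rotation (reverse xs) (reverse ys)
  Rotation-reverse (front , back , refl , refl) =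
    reverse back , reverse front , reverse-++ front back , reverse-++ back front

module _ {A B : Set} where

  Rotation-++-hom : (h : List A → List B) → (∀ xs ys → h (xs ++ ys) ≡ h xs ++ h ys) →
                    {xs ys : List A} → Rotation xs ys → Rotation (h xs) (h ys)
  Rotation-++-hom h h-++ (front , back , refl , refl) =
    h front , h back , h-++ front back , h-++ back front

  Unique-map⁺-local : {f : A → B} {xs : List A} →
                      (∀ {x y} → x ∈ xs → y ∈ xs → f x ≡ f y → x ≡ y) →
                      Unique xs → Unique (map f xs)
  Unique-map⁺-local {xs = []}     _   []           = []
  Unique-map⁺-local {xs = x ∷ xs} inj (x∉xs ∷ xs!) =
    All.map⁺ (All.tabulate λ y∈xs fx≡fy →
      All.lookup x∉xs y∈xs (inj (here refl) (there y∈xs) fx≡fy))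
    ∷ Unique-map⁺-local (λ x∈ y∈ → inj (there x∈) (there y∈)) xs!

prefixSums : List ℕ → List ℕ
prefixSums []       = []
prefixSums (x ∷ xs) = x ∷ map (x +_) (prefixSums xs)

prefixSums-++ : ∀ xs ys → prefixSums (xs ++ ys) ≡ prefixSums xs ++ map (sum xs +_) (prefixSums ys)
prefixSums-++ []       ys = sym (map-id (prefixSums ys))
prefixSums-++ (x ∷ xs) ys = cong (x ∷_) (begin
  map (x +_) (prefixSums (xs ++ ys))
    ≡⟨ cong (map (x +_)) (prefixSums-++ xs ys) ⟩
  map (x +_) (prefixSums xs ++ map (sum xs +_) (prefixSums ys))
    ≡⟨ map-++ (x +_) (prefixSums xs) _ ⟩
  map (x +_) (prefixSums xs) ++ map (x +_) (map (sum xs +_) (prefixSums ys))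
    ≡⟨ cong (map (x +_) (prefixSums xs) ++_) (map-∘ (prefixSums ys)) ⟨
  map (x +_) (prefixSums xs) ++ map (λ s → x + (sum xs + s)) (prefixSums ys)
    ≡⟨ cong (map (x +_) (prefixSums xs) ++_) (map-cong (+-assoc x (sum xs)) (prefixSums ys)) ⟨
  map (x +_) (prefixSums xs) ++ map (x + sum xs +_) (prefixSums ys) ∎)
  where open ≡-Reasoning

partialSums-prefixSums : ∀ w a xs → partialSums w a xs ≡ map (λ s → mod w (a + s)) (prefixSums xs)
partialSums-prefixSums w a []       = refl
partialSums-prefixSums w a (x ∷ xs) = cong (mod w (a + x) ∷_) (begin
  partialSums w (mod w (a + x)) xs
    ≡⟨ partialSums-prefixSums w (mod w (a + x)) xs ⟩
  map (λ s → mod w (mod w (a + x) + s)) (prefixSums xs)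
    ≡⟨ map-cong (λ s → trans (mod-+ w (a + x) s) (cong (mod w) (+-assoc a x s))) (prefixSums xs) ⟩
  map (λ s → mod w (a + (x + s))) (prefixSums xs)
    ≡⟨ map-∘ (prefixSums xs) ⟩
  map (λ s → mod w (a + s)) (map (x +_) (prefixSums xs)) ∎)
  where
  open ≡-Reasoning
  mod-+ : ∀ w a b → mod w (mod w a + b) ≡ mod w (a + b)
  mod-+ zero    a b = refl
  mod-+ (suc w) a b = Modulo.x%n+y≈x+y (suc w) a b

prefixSums-downFrom : ∀ f n →
  prefixSums (map f (downFrom n)) ≡ map (λ i → ∑< n f ∸ ∑< i f) (downFrom n)
prefixSums-downFrom f zero    = refl
prefixSums-downFrom f (suc n) = cong₂ _∷_ (sym (m+n∸n≡m (f n) (∑< n f))) (begin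
  map (f n +_) (prefixSums (map f (downFrom n)))
    ≡⟨ cong (map (f n +_)) (prefixSums-downFrom f n) ⟩
  map (f n +_) (map (λ i → ∑< n f ∸ ∑< i f) (downFrom n))
    ≡⟨ map-∘ (downFrom n) ⟨
  map (λ i → f n + (∑< n f ∸ ∑< i f)) (downFrom n)
    ≡⟨ map-cong-local (All.tabulate λ i∈ →
         sym (+-∸-assoc (f n) (∑<-mono-≤ f (<⇒≤ (∈-downFrom⁻ i∈))))) ⟩
  map (λ i → f n + ∑< n f ∸ ∑< i f) (downFrom n) ∎)
  where open ≡-Reasoning

prefixSums-upTo : ∀ f n → prefixSums (map f (upTo n)) ≡ map (λ i → ∑< (suc i) f) (upTo n)
prefixSums-upTo f zero    = refl
prefixSums-upTo f (suc n) = begin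
  prefixSums (map f (upTo (suc n)))
    ≡⟨ cong (prefixSums ∘ map f) (upTo-∷ʳ n) ⟨
  prefixSums (map f (upTo n ++ n ∷ []))
    ≡⟨ cong prefixSums (map-++ f (upTo n) (n ∷ [])) ⟩
  prefixSums (map f (upTo n) ++ f n ∷ [])
    ≡⟨ prefixSums-++ (map f (upTo n)) (f n ∷ []) ⟩
  prefixSums (map f (upTo n)) ++ sum (map f (upTo n)) + f n ∷ []
    ≡⟨ cong₂ (λ xs x → xs ++ x ∷ []) (prefixSums-upTo f n)
             (trans (cong (_+ f n) (sum-map-upTo n f)) (+-comm (∑< n f) (f n))) ⟩
  map (λ i → ∑< (suc i) f) (upTo n) ++ ∑< (suc n) f ∷ []
    ≡⟨ map-++ (λ i → ∑< (suc i) f) (upTo n) (n ∷ []) ⟨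
  map (λ i → ∑< (suc i) f) (upTo n ++ n ∷ [])
    ≡⟨ cong (map (λ i → ∑< (suc i) f)) (upTo-∷ʳ n) ⟩
  map (λ i → ∑< (suc i) f) (upTo (suc n)) ∎
  where open ≡-Reasoning

-- Zero-sum sequences with distinct partial sums

module ZeroSumSequences (m : ℕ) .{{_ : NonZero m}} where
  open Modulo m

  ZeroSumSimple : List ℕ → Set
  ZeroSumSimple xs = sum xs ≈ 0 × Unique (map (_% m) (prefixSums xs))

  private
    unshift : ∀ a xs → Unique (map (λ s → (a + s) % m) xs) → Unique (map (_% m) xs)
    unshift a xs = Unique.map⁻ ∘ subst Unique (begin
      map (λ s → (a + s) % m) xs
        ≡⟨ map-cong (λ s → sym (+-cong {a} {a} {s % m} {s} refl (x%n≈x s))) xs ⟩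
      map (λ s → (a + s % m) % m) xs
        ≡⟨ map-∘ xs ⟩
      map (λ z → (a + z) % m) (map (_% m) xs) ∎)
      where open ≡-Reasoning

  -- The prefix sums of F reached after B have gone once around F ++ B, adding sum (F ++ B) ≈ 0.
  prefixSums-rotate : ∀ F B → sum (F ++ B) ≈ 0 →
                      map (λ s → (sum F + s) % m) (prefixSums (B ++ F)) ≡
                      map (_% m) (map (sum F +_) (prefixSums B)) ++ map (_% m) (prefixSums F)
  prefixSums-rotate F B total≈0 = begin
    map (λ s → (sum F + s) % m) (prefixSums (B ++ F))
      ≡⟨ cong (map _) (prefixSums-++ B F) ⟩
    map (λ s → (sum F + s) % m) (prefixSums B ++ map (sum B +_) (prefixSums F))
      ≡⟨ map-++ _ (prefixSums B) _ ⟩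
    map (λ s → (sum F + s) % m) (prefixSums B) ++
    map (λ s → (sum F + s) % m) (map (sum B +_) (prefixSums F))
      ≡⟨ cong₂ _++_ (map-∘ (prefixSums B))
                    (trans (sym (map-∘ (prefixSums F))) (map-cong turn (prefixSums F))) ⟩
    map (_% m) (map (sum F +_) (prefixSums B)) ++ map (_% m) (prefixSums F) ∎
    where
    open ≡-Reasoning
    turn : ∀ s → (sum F + (sum B + s)) % m ≡ s % m
    turn s = begin
      (sum F + (sum B + s)) % m
        ≡⟨ cong (_% m) (trans (sym (+-assoc (sum F) (sum B) s)) (cong (_+ s) (sym (sum-++ F B)))) ⟩
      (sum (F ++ B) + s) % m
        ≡⟨ +-cong {sum (F ++ B)} {0} {s} {s} total≈0 refl ⟩
      s % m ∎

  zeroSumSimple-rotation : ∀ {xs ys} → Rotation xs ys → ZeroSumSimple xs → ZeroSumSimple ys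
  zeroSumSimple-rotation (F , B , refl , refl) (total≈0 , simple) =
    total′≈0 ,
    unshift (sum F) (prefixSums (B ++ F)) (subst Unique (sym (prefixSums-rotate F B total≈0)) swapped)
    where
    total′≈0 : sum (B ++ F) ≈ 0
    total′≈0 = trans (cong (_% m) (trans (sum-++ B F) (trans (+-comm (sum B) (sum F))
                                                              (sym (sum-++ F B))))) total≈0
    swapped : Unique (map (_% m) (map (sum F +_) (prefixSums B)) ++ map (_% m) (prefixSums F))
    swapped = Unique-resp-↭ (↭⇒↭ₛ (++-comm (map (_% m) (prefixSums F)) _))
      (subst Unique (trans (cong (map (_% m)) (prefixSums-++ F B)) (map-++ (_% m) (prefixSums F) _)) simple)

  private
    prefixSums-resp-% : ∀ {a b} xs ys → a ≈ b → map (_% m) xs ≡ map (_% m) ys →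
                        map (λ s → (a + s) % m) (prefixSums xs) ≡
                        map (λ s → (b + s) % m) (prefixSums ys)
    prefixSums-resp-% []       []       a≈b _  = refl
    prefixSums-resp-% {a} {b} (x ∷ xs) (y ∷ ys) a≈b xs≈ys = cong₂ _∷_ a+x≈b+y (begin
      map (λ s → (a + s) % m) (map (x +_) (prefixSums xs))
        ≡⟨ map-∘ (prefixSums xs) ⟨
      map (λ s → (a + (x + s)) % m) (prefixSums xs)
        ≡⟨ map-cong (λ s → cong (_% m) (+-assoc a x s)) (prefixSums xs) ⟨
      map (λ s → (a + x + s) % m) (prefixSums xs)
        ≡⟨ prefixSums-resp-% xs ys a+x≈b+y (∷-injectiveʳ xs≈ys) ⟩
      map (λ s → (b + y + s) % m) (prefixSums ys)
        ≡⟨ map-cong (λ s → cong (_% m) (+-assoc b y s)) (prefixSums ys) ⟩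
      map (λ s → (b + (y + s)) % m) (prefixSums ys)
        ≡⟨ map-∘ (prefixSums ys) ⟩
      map (λ s → (b + s) % m) (map (y +_) (prefixSums ys)) ∎)
      where
      open ≡-Reasoning
      a+x≈b+y : a + x ≈ b + y
      a+x≈b+y = +-cong {a} {b} {x} {y} a≈b (∷-injectiveˡ xs≈ys)

    sum-resp-% : ∀ xs ys → map (_% m) xs ≡ map (_% m) ys → sum xs ≈ sum ys
    sum-resp-% []       []       _      = refl
    sum-resp-% (x ∷ xs) (y ∷ ys) xs≈ys =
      +-cong {x} {y} {sum xs} {sum ys} (∷-injectiveˡ xs≈ys) (sum-resp-% xs ys (∷-injectiveʳ xs≈ys))

  zeroSumSimple-resp-% : ∀ {xs ys} → map (_% m) xs ≡ map (_% m) ys →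
                         ZeroSumSimple xs → ZeroSumSimple ys
  zeroSumSimple-resp-% {xs} {ys} xs≈ys (total≈0 , simple) =
    trans (sym (sum-resp-% xs ys xs≈ys)) total≈0 ,
    subst Unique (prefixSums-resp-% {0} {0} xs ys refl xs≈ys) simple

  zeroSumSimple⇒simpleOrdering : ∀ w .{{_ : NonZero w}} → m ∣ w →
                                 ∀ {xs} → ZeroSumSimple xs → SimpleOrdering w xs
  zeroSumSimple⇒simpleOrdering w m∣w {xs} (_ , simple) =
    subst Unique (sym (trans (partialSums-prefixSums w 0 xs) (map-cong (mod≡% w) (prefixSums xs))))
      (Unique.map⁻ {f = _% m} (subst Unique residues simple))
    where
    residues : map (_% m) (prefixSums xs) ≡ map (_% m) (map (_% w) (prefixSums xs))
    residues = trans (map-cong (λ s → sym (m∣n⇒o%n%m≡o%m m w s m∣w)) (prefixSums xs))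
                     (map-∘ (prefixSums xs))

  module _ {γ : ℕ → ℕ} {k : ℕ} (total≈0 : ∑< k γ ≈ 0)
           (∑<-injective : ∀ {i j} → i < k → j < k → ∑< i γ ≈ ∑< j γ → i ≡ j) where

    zeroSumSimple-downFrom : ZeroSumSimple (map γ (downFrom k))
    zeroSumSimple-downFrom = total≈0 , subst Unique (sym residues) (Unique.applyDownFrom⁺₁ _ k distinct)
      where
      T : ℕ
      T = ∑< k γ
      residues : map (_% m) (prefixSums (map γ (downFrom k))) ≡
                 applyDownFrom (λ i → (T ∸ ∑< i γ) % m) k
      residues = trans (cong (map (_% m)) (prefixSums-downFrom γ k))
                       (trans (sym (map-∘ (downFrom k))) (map-downFrom _ k))
      distinct : ∀ {i j} → j < i → i < k → (T ∸ ∑< i γ) % m ≢ (T ∸ ∑< j γ) % m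
      distinct {i} {j} j<i i<k a≈b = <⇒≢ j<i (∑<-injective (<-trans j<i i<k) i<k ∑<j≈∑<i)
        where
        open import Relation.Binary.Reasoning.Setoid ≈-setoid
        a b : ℕ
        a = T ∸ ∑< i γ
        b = T ∸ ∑< j γ
        ∑<j≈∑<i : ∑< j γ ≈ ∑< i γ
        ∑<j≈∑<i = +-cancelˡ b (begin
          b + ∑< j γ     ≡⟨ m∸n+n≡m (∑<-mono-≤ γ (<⇒≤ (<-trans j<i i<k))) ⟩
          T              ≡⟨ m∸n+n≡m (∑<-mono-≤ γ (<⇒≤ i<k)) ⟨
          a + ∑< i γ     ≈⟨ +-cong {a} {b} {∑< i γ} {∑< i γ} a≈b refl ⟩
          b + ∑< i γ     ∎)

    zeroSumSimple-upTo : ZeroSumSimple (map γ (upTo k))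
    zeroSumSimple-upTo =
      trans (cong (_% m) (sum-map-upTo k γ)) total≈0 ,
      subst Unique (sym residues) (Unique.applyUpTo⁺₁ _ k distinct)
      where
      residues : map (_% m) (prefixSums (map γ (upTo k))) ≡ applyUpTo (λ i → ∑< (suc i) γ % m) k
      residues = trans (cong (map (_% m)) (prefixSums-upTo γ k))
                       (trans (sym (map-∘ (upTo k))) (map-upTo _ k))
      distinct : ∀ {i j} → i < j → j < k → ∑< (suc i) γ % m ≢ ∑< (suc j) γ % m
      distinct {i} {j} i<j j<k ∑<i≈∑<j with m≤n⇒m<n∨m≡n j<k
      ... | inj₁ 1+j<k = <⇒≢ (s≤s i<j) (∑<-injective (<-trans (s≤s i<j) 1+j<k) 1+j<k ∑<i≈∑<j)
      ... | inj₂ refl  = 1+n≢0 (∑<-injective (s≤s i<j) (s≤s z≤n) (trans ∑<i≈∑<j total≈0))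

applyUpTo-+ : ∀ {A : Set} (f : ℕ → A) a b →
              applyUpTo f (a + b) ≡ applyUpTo f a ++ applyUpTo (f ∘ (a +_)) b
applyUpTo-+ f zero    b = refl
applyUpTo-+ f (suc a) b = cong (f 0 ∷_) (applyUpTo-+ (f ∘ suc) a b)

upTo-+ : ∀ a b → upTo (a + b) ≡ upTo a ++ map (a +_) (upTo b)
upTo-+ a b = trans (applyUpTo-+ (λ i → i) a b) (cong (upTo a ++_) (sym (map-upTo (a +_) b)))

upTo-split : ∀ {a n} → a ≤ n → upTo n ≡ upTo a ++ map (a +_) (upTo (n ∸ a))
upTo-split {a} {n} a≤n = trans (cong upTo (sym (m+[n∸m]≡n a≤n))) (upTo-+ a (n ∸ a))

applyDownFrom-+ : ∀ {A : Set} (f : ℕ → A) a b →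
                  applyDownFrom f (a + b) ≡ applyDownFrom (f ∘ (b +_)) a ++ applyDownFrom f b
applyDownFrom-+ f zero    b = refl
applyDownFrom-+ f (suc a) b = cong₂ _∷_ (cong f (+-comm a b)) (applyDownFrom-+ f a b)

downFrom-split : ∀ {a n} → a ≤ n → downFrom n ≡ map (a +_) (downFrom (n ∸ a)) ++ downFrom a
downFrom-split {a} {n} a≤n = begin
  downFrom n                                         ≡⟨ cong downFrom (m∸n+n≡m a≤n) ⟨
  downFrom (n ∸ a + a)                               ≡⟨ applyDownFrom-+ (λ i → i) (n ∸ a) a ⟩
  applyDownFrom (a +_) (n ∸ a) ++ downFrom a          ≡⟨ cong (_++ downFrom a) (map-downFrom (a +_) (n ∸ a)) ⟨
  map (a +_) (downFrom (n ∸ a)) ++ downFrom a         ∎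
  where open ≡-Reasoning

map-downFrom-upTo : ∀ {A : Set} (h : ℕ → A) n →
                    map h (downFrom n) ≡ map (λ c → h (n ∸ suc c)) (upTo n)
map-downFrom-upTo h zero    = refl
map-downFrom-upTo h (suc n) = cong (h n ∷_) (begin
  map h (downFrom n)                               ≡⟨ map-downFrom-upTo h n ⟩
  map (λ c → h (n ∸ suc c)) (upTo n)               ≡⟨ map-upTo _ n ⟩
  applyUpTo (λ c → h (n ∸ suc c)) n                ≡⟨ map-applyUpTo suc _ n ⟨
  map (λ c → h (suc n ∸ suc c)) (applyUpTo suc n)  ∎)
  where open ≡-Reasoning

map-toℕ-allFin : ∀ {A : Set} (f : ℕ → A) n → map (f ∘ toℕ) (allFin n) ≡ map f (upTo n)
map-toℕ-allFin f n =
  trans (map-tabulate (λ i → i) (f ∘ toℕ)) (trans (tabulate-toℕ f n) (sym (map-upTo f n)))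
  where
  tabulate-toℕ : ∀ {A : Set} (f : ℕ → A) n → tabulate {n = n} (f ∘ toℕ) ≡ applyUpTo f n
  tabulate-toℕ f zero    = refl
  tabulate-toℕ f (suc n) = cong (f 0 ∷_) (tabulate-toℕ (f ∘ suc) n)

module _ (n : ℕ) .{{_ : NonZero n}} where

  Rotation-upTo-shift : ∀ {a} → a ≤ n → Rotation (upTo n) (map (λ i → (a + i) % n) (upTo n))
  Rotation-upTo-shift {a} a≤n = upTo a , map (a +_) (upTo (n ∸ a)) , upTo-split a≤n , (begin
    map (λ i → (a + i) % n) (upTo n)
      ≡⟨ cong (map _) (trans (cong upTo (sym (m∸n+n≡m a≤n))) (upTo-+ (n ∸ a) a)) ⟩
    map (λ i → (a + i) % n) (upTo (n ∸ a) ++ map (n ∸ a +_) (upTo a))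
      ≡⟨ map-++ _ (upTo (n ∸ a)) _ ⟩
    map (λ i → (a + i) % n) (upTo (n ∸ a)) ++ map (λ i → (a + i) % n) (map (n ∸ a +_) (upTo a))
      ≡⟨ cong₂ _++_ (map-cong-local (All.tabulate λ i∈ → m<n⇒m%n≡m (no-wrap (∈-upTo⁻ i∈))))
                    (trans (sym (map-∘ (upTo a)))
                           (trans (map-cong-local (All.tabulate λ j∈ → wrap (∈-upTo⁻ j∈))) (map-id (upTo a)))) ⟩
    map (a +_) (upTo (n ∸ a)) ++ upTo a ∎)
    where
    open ≡-Reasoning
    no-wrap : ∀ {i} → i < n ∸ a → a + i < n
    no-wrap {i} i<n∸a = subst (a + i <_) (m+[n∸m]≡n a≤n) (+-monoʳ-< a i<n∸a)
    wrap : ∀ {j} → j < a → (a + (n ∸ a + j)) % n ≡ j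
    wrap {j} j<a = begin
      (a + (n ∸ a + j)) % n   ≡⟨ cong (_% n) (+-assoc a (n ∸ a) j) ⟨
      (a + (n ∸ a) + j) % n   ≡⟨ cong (λ z → (z + j) % n) (m+[n∸m]≡n a≤n) ⟩
      (n + j) % n             ≡⟨ cong (_% n) (+-comm n j) ⟩
      (j + n) % n             ≡⟨ [m+n]%n≡m%n j n ⟩
      j % n                   ≡⟨ m<n⇒m%n≡m (<-≤-trans j<a a≤n) ⟩
      j                       ∎

  Rotation-downFrom-shift : ∀ {r} → r < n →
                            Rotation (downFrom n) (map (λ c → (r + (n ∸ c)) % n) (upTo n))
  Rotation-downFrom-shift {r} r<n =
    subst₂ Rotation (reverse-upTo n) reversed (Rotation-reverse (Rotation-upTo-shift r<n))
    where
    open ≡-Reasoning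
    reversed : reverse (map (λ i → (suc r + i) % n) (upTo n)) ≡ map (λ c → (r + (n ∸ c)) % n) (upTo n)
    reversed = begin
      reverse (map (λ i → (suc r + i) % n) (upTo n))
        ≡⟨ reverse-map _ (upTo n) ⟨
      map (λ i → (suc r + i) % n) (reverse (upTo n))
        ≡⟨ cong (map _) (reverse-upTo n) ⟩
      map (λ i → (suc r + i) % n) (downFrom n)
        ≡⟨ map-downFrom-upTo _ n ⟩
      map (λ c → (suc r + (n ∸ suc c)) % n) (upTo n)
        ≡⟨ map-cong-local (All.tabulate λ c∈ → cong (_% n)
             (trans (sym (+-suc r _)) (cong (r +_) (sym (+-∸-assoc 1 (∈-upTo⁻ c∈)))))) ⟩
      map (λ c → (r + (n ∸ c)) % n) (upTo n) ∎

module _ {A : Set} (k : ℕ) where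

  restrict : (ℕ → A) → ℕ → Maybe A
  restrict f D = if does (D <? k) then just (f D) else nothing

  is-just-restrict : ∀ f D → is-just (restrict f D) ≡ does (D <? k)
  is-just-restrict f D with does (D <? k)
  ... | true  = refl
  ... | false = refl

  catMaybes-restrict-++ : ∀ f xs ys → catMaybes (map (restrict f) (xs ++ ys)) ≡
                          catMaybes (map (restrict f) xs) ++ catMaybes (map (restrict f) ys)
  catMaybes-restrict-++ f xs ys =
    trans (cong catMaybes (map-++ (restrict f) xs ys)) (catMaybes-++ (map (restrict f) xs) _)

  catMaybes-restrict-< : ∀ f {xs} → All (_< k) xs → catMaybes (map (restrict f) xs) ≡ map f xs
  catMaybes-restrict-< f []                   = refl
  catMaybes-restrict-< f {D ∷ _} (D<k ∷ xs<k) rewrite dec-true (D <? k) D<k =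
    cong (f D ∷_) (catMaybes-restrict-< f xs<k)

  catMaybes-restrict-≥ : ∀ f {xs} → All (k ≤_) xs → catMaybes (map (restrict f) xs) ≡ []
  catMaybes-restrict-≥ f []                   = refl
  catMaybes-restrict-≥ f {D ∷ _} (k≤D ∷ k≤xs) rewrite dec-false (D <? k) (≤⇒≯ k≤D) =
    catMaybes-restrict-≥ f k≤xs

  module _ {n} (k≤n : k ≤ n) (f : ℕ → A) where

    private
      shifted-≥ : ∀ xs → All (k ≤_) (map (k +_) xs)
      shifted-≥ xs = All.map⁺ {xs = xs} (All.tabulate λ {j} _ → m≤m+n k j)

    catMaybes-restrict-upTo : catMaybes (map (restrict f) (upTo n)) ≡ map f (upTo k)
    catMaybes-restrict-upTo = begin
      catMaybes (map (restrict f) (upTo n))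
        ≡⟨ cong (catMaybes ∘ map (restrict f)) (upTo-split k≤n) ⟩
      catMaybes (map (restrict f) (upTo k ++ map (k +_) (upTo (n ∸ k))))
        ≡⟨ catMaybes-restrict-++ f (upTo k) _ ⟩
      catMaybes (map (restrict f) (upTo k)) ++ catMaybes (map (restrict f) (map (k +_) (upTo (n ∸ k))))
        ≡⟨ cong₂ _++_ (catMaybes-restrict-< f (All.tabulate ∈-upTo⁻))
                      (catMaybes-restrict-≥ f (shifted-≥ (upTo (n ∸ k)))) ⟩
      map f (upTo k) ++ []
        ≡⟨ ++-identityʳ (map f (upTo k)) ⟩
      map f (upTo k) ∎
      where open ≡-Reasoning

    catMaybes-restrict-downFrom : catMaybes (map (restrict f) (downFrom n)) ≡ map f (downFrom k)
    catMaybes-restrict-downFrom = begin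
      catMaybes (map (restrict f) (downFrom n))
        ≡⟨ cong (catMaybes ∘ map (restrict f)) (downFrom-split k≤n) ⟩
      catMaybes (map (restrict f) (map (k +_) (downFrom (n ∸ k)) ++ downFrom k))
        ≡⟨ catMaybes-restrict-++ f (map (k +_) (downFrom (n ∸ k))) _ ⟩
      catMaybes (map (restrict f) (map (k +_) (downFrom (n ∸ k)))) ++ catMaybes (map (restrict f) (downFrom k))
        ≡⟨ cong₂ _++_ (catMaybes-restrict-≥ f (shifted-≥ (downFrom (n ∸ k))))
                      (catMaybes-restrict-< f (All.tabulate ∈-downFrom⁻)) ⟩
      map f (downFrom k) ∎
      where open ≡-Reasoning

-- Arrays supported on k consecutive diagonals

-- Our diagonal d is the paper's D_{d+1}; entry D r is the entry of row r on diagonal D.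
module DiagonalArray (p k : ℕ) .{{_ : NonZero p}} (k≤p : k ≤ p) (entry : ℕ → ℕ → ℕ) where

  diagonal : ℕ → ℕ → ℕ
  diagonal r c = (r + (p ∸ c)) % p

  array : Array p
  array r c = restrict k (λ D → entry D (toℕ r)) (diagonal (toℕ r) (toℕ c))

  rowList-rotation : ∀ r → Rotation (map (λ D → entry D (toℕ r)) (downFrom k)) (rowList array r)
  rowList-rotation r = subst₂ Rotation (catMaybes-restrict-downFrom k k≤p entryᵣ) (sym rowList≡)
    (Rotation-++-hom (catMaybes ∘ map (restrict k entryᵣ)) (catMaybes-restrict-++ k entryᵣ)
      (Rotation-downFrom-shift p (toℕ<n r)))
    where
    entryᵣ : ℕ → ℕ
    entryᵣ D = entry D (toℕ r)
    rowList≡ : rowList array r ≡ catMaybes (map (restrict k entryᵣ) (map (diagonal (toℕ r)) (upTo p)))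
    rowList≡ = cong catMaybes
      (trans (map-toℕ-allFin (restrict k entryᵣ ∘ diagonal (toℕ r)) p) (map-∘ (upTo p)))

  column+diagonal≡row : ∀ {r c} → c < p → r < p → (c + diagonal r c) % p ≡ r
  column+diagonal≡row {r} {c} c<p r<p = begin
    (c + (r + (p ∸ c)) % p) % p
      ≡⟨ Modulo.+-cong p {c} {c} {(r + (p ∸ c)) % p} {r + (p ∸ c)} refl (Modulo.x%n≈x p (r + (p ∸ c))) ⟩
    (c + (r + (p ∸ c))) % p
      ≡⟨ cong (_% p) (trans (+-comm c _) (trans (+-assoc r (p ∸ c) c) (cong (r +_) (m∸n+n≡m (<⇒≤ c<p))))) ⟩
    (r + p) % p
      ≡⟨ [m+n]%n≡m%n r p ⟩
    r % p
      ≡⟨ m<n⇒m%n≡m r<p ⟩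
    r ∎
    where open ≡-Reasoning

  colList-rotation : ∀ c → Rotation (map (λ D → entry D ((toℕ c + D) % p)) (upTo k)) (colList array c)
  colList-rotation c = subst₂ Rotation (catMaybes-restrict-upTo k k≤p entryᶜ) (sym colList≡)
    (Rotation-++-hom (catMaybes ∘ map (restrict k entryᶜ)) (catMaybes-restrict-++ k entryᶜ)
      (Rotation-upTo-shift p (m∸n≤m p C)))
    where
    open ≡-Reasoning
    C : ℕ
    C = toℕ c
    entryᶜ : ℕ → ℕ
    entryᶜ D = entry D ((C + D) % p)
    cell≡ : ∀ {r} → r < p →
            restrict k (λ D → entry D r) (diagonal r C) ≡ restrict k entryᶜ ((p ∸ C + r) % p)
    cell≡ {r} r<p = begin
      restrict k (λ D → entry D r) (diagonal r C)
        ≡⟨ cong (λ x → if does (diagonal r C <? k) then just (entry (diagonal r C) x) else nothing)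
                (sym (column+diagonal≡row (toℕ<n c) r<p)) ⟩
      restrict k entryᶜ (diagonal r C)
        ≡⟨ cong (restrict k entryᶜ ∘ (_% p)) (+-comm r (p ∸ C)) ⟩
      restrict k entryᶜ ((p ∸ C + r) % p) ∎
    colList≡ : colList array c ≡
               catMaybes (map (restrict k entryᶜ) (map (λ r → (p ∸ C + r) % p) (upTo p)))
    colList≡ = cong catMaybes (begin
      map (λ i → array i c) (allFin p)
        ≡⟨ map-toℕ-allFin (λ r → restrict k (λ D → entry D r) (diagonal r C)) p ⟩
      map (λ r → restrict k (λ D → entry D r) (diagonal r C)) (upTo p)
        ≡⟨ map-cong-local (All.tabulate λ r∈ → cell≡ (∈-upTo⁻ r∈)) ⟩
      map (λ r → restrict k entryᶜ ((p ∸ C + r) % p)) (upTo p)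
        ≡⟨ map-∘ (upTo p) ⟩
      map (restrict k entryᶜ) (map (λ r → (p ∸ C + r) % p) (upTo p)) ∎)

  cyclicallyKDiagonal : CyclicallyKDiagonal p k array
  cyclicallyKDiagonal = zeroᶠ , λ r c → mk⇔ (onDiagonal r c) (filled r c)
    where
    zeroᶠ : Fin p
    zeroᶠ = fromℕ< (>-nonZero⁻¹ p)
    shift-by-zero : ∀ {j} → j < p → mod p (toℕ zeroᶠ + j) ≡ j
    shift-by-zero {j} j<p =
      trans (mod≡% p _) (trans (cong (λ z → (z + j) % p) (toℕ-fromℕ< (>-nonZero⁻¹ p))) (m<n⇒m%n≡m j<p))
    onDiagonal : ∀ r c → is-just (array r c) ≡ true → OnDiagonals p k zeroᶠ r c
    onDiagonal r c filled =
      D , witness (D <? k) (trans (sym (is-just-restrict k (λ D → entry D (toℕ r)) D)) filled) ,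
      trans (mod≡% p _) (sym (shift-by-zero (m%n<n _ p)))
      where
      D : ℕ
      D = diagonal (toℕ r) (toℕ c)
      witness : ∀ {P : Set} (P? : Dec P) → does P? ≡ true → P
      witness (yes P) _ = P
    filled : ∀ r c → OnDiagonals p k zeroᶠ r c → is-just (array r c) ≡ true
    filled r c (j , j<k , eq) = trans (is-just-restrict k (λ D → entry D (toℕ r)) D) (dec-true (D <? k) D<k)
      where
      D : ℕ
      D = diagonal (toℕ r) (toℕ c)
      D<k : D < k
      D<k = subst (_< k) (sym (trans (sym (mod≡% p _)) (trans eq (shift-by-zero (<-≤-trans j<k k≤p))))) j<k

  row : Fin p → List ℕ
  row r = map (λ D → entry D (toℕ r)) (downFrom k)

  entries-↭ : entries array ↭ concat (map row (allFin p))
  entries-↭ = concat-map-↭ (allFin p) (λ r → ↭-sym (Rotation⇒↭ (rowList-rotation r)))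
    where
    concat-map-↭ : ∀ {f g : Fin p → List ℕ} xs → (∀ x → f x ↭ g x) →
                   concat (map f xs) ↭ concat (map g xs)
    concat-map-↭ []       f↭g = ↭-refl
    concat-map-↭ (x ∷ xs) f↭g = ++⁺ (f↭g x) (concat-map-↭ xs f↭g)

  ∈-entries⁻ : ∀ {x} → x ∈ entries array → ∃[ D ] ∃[ r ] D < k × r < p × x ≡ entry D r
  ∈-entries⁻ x∈ with ∈-concat⁻′ (map row (allFin p)) (∈-resp-↭ entries-↭ x∈)
  ... | xs , x∈xs , xs∈rows with ∈-map⁻ row xs∈rows
  ... | r , _ , refl with ∈-map⁻ (λ D → entry D (toℕ r)) x∈xs
  ... | D , D∈ , refl = D , toℕ r , ∈-downFrom⁻ D∈ , toℕ<n r , refl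

  ∈-entries⁺ : ∀ {D r} → D < k → r < p → entry D r ∈ entries array
  ∈-entries⁺ {D} {r} D<k r<p =
    ∈-resp-↭ (↭-sym entries-↭) (∈-concat⁺′ D∈row (∈-map⁺ row (∈-allFin (fromℕ< r<p))))
    where
    D∈row : entry D r ∈ row (fromℕ< r<p)
    D∈row = subst (λ r′ → entry D r ∈ map (λ D → entry D r′) (downFrom k)) (sym (toℕ-fromℕ< r<p))
                  (∈-map⁺ (λ D → entry D r) (∈-downFrom⁺ D<k))

  length-entries : length (entries array) ≡ p * k
  length-entries = begin
    length (entries array)               ≡⟨ ↭-length entries-↭ ⟩
    length (concat (map row (allFin p))) ≡⟨ length-rows (allFin p) ⟩
    length (allFin p) * k                ≡⟨ cong (_* k) (length-tabulate {n = p} (λ i → i)) ⟩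
    p * k                                ∎
    where
    open ≡-Reasoning
    length-rows : ∀ rs → length (concat (map row rs)) ≡ length rs * k
    length-rows []       = refl
    length-rows (r ∷ rs) = trans (length-++ (row r))
      (cong₂ _+_ (trans (length-map _ (downFrom k)) (length-downFrom k)) (length-rows rs))

  entries-unique : (∀ {D D′ r r′} → D < k → D′ < k → r < p → r′ < p →
                    entry D r ≡ entry D′ r′ → D ≡ D′ × r ≡ r′) →
                   Unique (entries array)
  entries-unique entry-injective = Unique-resp-↭ (↭⇒↭ₛ (↭-sym entries-↭))
    (Unique.concat⁺ (All.map⁺ (All.universal row-unique (allFin p)))
                    (AllPairs.map⁺ (AllPairs.map rows-disjoint (Unique.allFin⁺ p))))
    where
    row-unique : ∀ r → Unique (row r)
    row-unique r = Unique-map⁺-local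
      (λ D∈ D′∈ eq → proj₁ (entry-injective (∈-downFrom⁻ D∈) (∈-downFrom⁻ D′∈)
                                            (toℕ<n r) (toℕ<n r) eq))
      (Unique.downFrom⁺ k)
    rows-disjoint : ∀ {r r′} → r ≢ r′ → Disjoint (row r) (row r′)
    rows-disjoint {r} {r′} r≢r′ (x∈ , x∈′)
      with ∈-map⁻ (λ D → entry D (toℕ r)) x∈ | ∈-map⁻ (λ D → entry D (toℕ r′)) x∈′
    ... | D , D∈ , refl | D′ , D′∈ , eq = r≢r′ (toℕ-injective
      (proj₂ (entry-injective (∈-downFrom⁻ D∈) (∈-downFrom⁻ D′∈) (toℕ<n r) (toℕ<n r′) eq)))

-- Affine maps modulo a prime

module AffineModPrime (p : ℕ) .{{_ : NonZero p}} (p-prime : Prime p) where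
  open Modulo p
  open import Relation.Binary.Reasoning.Setoid ≈-setoid

  private
    inverse-cancelˡ : ∀ {a b} x → b * a ≈ 1 → b * (a * x) ≈ x
    inverse-cancelˡ {a} {b} x b*a≈1 = begin
      b * (a * x)    ≡⟨ *-assoc b a x ⟨
      b * a * x      ≈⟨ *-cong {b * a} {1} {x} {x} b*a≈1 refl ⟩
      1 * x          ≡⟨ *-identityˡ x ⟩
      x              ∎

  inverse : ∀ {a} → 0 < a → a < p → ∃[ b ] b * a ≈ 1
  inverse {a} 0<a a<p with coprime-Bézout (prime⇒coprime p-prime {{>-nonZero 0<a}} a<p)
  ... | Bézout.-+ x y 1+xp≡ya = y , (begin
    y * a          ≡⟨ 1+xp≡ya ⟨
    1 + x * p      ≈⟨ +-cong {1} {1} {x * p} {0} refl (x*n≈0 x) ⟩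
    1 + 0          ≡⟨ +-identityʳ 1 ⟩
    1              ∎)
  ... | Bézout.+- x y 1+ya≡xp = (p ∸ 1) * y , +-cancelˡ (p ∸ 1) (begin
    p ∸ 1 + (p ∸ 1) * y * a          ≡⟨ distribute (p ∸ 1) y a ⟩
    (p ∸ 1) * (1 + y * a)            ≡⟨ cong ((p ∸ 1) *_) 1+ya≡xp ⟩
    (p ∸ 1) * (x * p)                ≡⟨ *-assoc (p ∸ 1) x p ⟨
    (p ∸ 1) * x * p                  ≈⟨ x*n≈0 ((p ∸ 1) * x) ⟩
    0                                ≈⟨ x*n≈0 1 ⟨
    1 * p                            ≡⟨ *-identityˡ p ⟩
    p                                ≡⟨ m∸n+n≡m (>-nonZero⁻¹ p) ⟨
    p ∸ 1 + 1                        ∎)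
    where
    distribute : ∀ c y a → c + c * y * a ≡ c * (1 + y * a)
    distribute = solve-∀

  affine-injective : ∀ {a} t → 0 < a → a < p → ∀ {r r′} → r < p → r′ < p →
                     (a * r + t) % p ≡ (a * r′ + t) % p → r ≡ r′
  affine-injective {a} t 0<a a<p {r} {r′} r<p r′<p eq with inverse 0<a a<p
  ... | b , b*a≈1 = ≈-window⇒≡ z≤n r<p z≤n r′<p (begin
    r              ≈⟨ inverse-cancelˡ {a} {b} r b*a≈1 ⟨
    b * (a * r)    ≈⟨ *-cong {b} {b} {a * r} {a * r′} refl ar≈ar′ ⟩
    b * (a * r′)   ≈⟨ inverse-cancelˡ {a} {b} r′ b*a≈1 ⟩
    r′             ∎)
    where
    ar≈ar′ : a * r ≈ a * r′
    ar≈ar′ = +-cancelˡ t (begin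
      t + a * r      ≡⟨ +-comm t (a * r) ⟩
      a * r + t      ≈⟨ eq ⟩
      a * r′ + t     ≡⟨ +-comm (a * r′) t ⟩
      t + a * r′     ∎)

  affine-surjective : ∀ {a} t → 0 < a → a < p → ∀ {y} → y < p → ∃[ r ] r < p × (a * r + t) % p ≡ y
  affine-surjective {a} t 0<a a<p {y} y<p with inverse 0<a a<p
  ... | b , b*a≈1 = (b * s) % p , m%n<n _ p , trans hits (m<n⇒m%n≡m y<p)
    where
    s : ℕ
    s = y + negate t
    swap : ∀ a b s → a * (b * s) ≡ b * (a * s)
    swap = solve-∀
    hits : a * ((b * s) % p) + t ≈ y
    hits = begin
      a * ((b * s) % p) + t  ≈⟨ +-cong {a * ((b * s) % p)} {a * (b * s)} {t} {t}
                                        (*-cong {a} {a} {(b * s) % p} {b * s} refl (x%n≈x (b * s))) refl ⟩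
      a * (b * s) + t        ≡⟨ cong (_+ t) (swap a b s) ⟩
      b * (a * s) + t        ≈⟨ +-cong {b * (a * s)} {s} {t} {t} (inverse-cancelˡ {a} {b} s b*a≈1) refl ⟩
      y + negate t + t       ≡⟨ +-assoc y (negate t) t ⟩
      y + (negate t + t)     ≈⟨ +-cong {y} {y} {negate t + t} {0} refl (negate-inverseˡ t) ⟩
      y + 0                  ≡⟨ +-identityʳ y ⟩
      y                      ∎

-- Heffter arrays from diagonals

record SimpleZeroSumHalfSet (k : ℕ) (γ : ℕ → ℕ) : Set where
  field
    γ-range             : ∀ {i} → i < k → 0 < γ i × γ i < suc (k + k)
    γ-injective         : ∀ {i j} → i < k → j < k → γ i ≡ γ j → i ≡ j
    γ-covers            : ∀ {x} → 0 < x → x < suc (k + k) →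
                          ∃[ i ] i < k × (γ i ≡ x ⊎ γ i ≡ suc (k + k) ∸ x)
    sum≡0               : ∑< k γ % suc (k + k) ≡ 0
    prefixSum-injective : ∀ {i j} → i < k → j < k →
                          ∑< i γ % suc (k + k) ≡ ∑< j γ % suc (k + k) → i ≡ j

sumMod≡% : ∀ w .{{_ : NonZero w}} xs → sumMod w xs ≡ sum xs % w
sumMod≡% w []       = sym (Modulo.0%n≡0 w)
sumMod≡% w (x ∷ xs) = begin
  mod w (x + sumMod w xs)     ≡⟨ mod≡% w _ ⟩
  (x + sumMod w xs) % w       ≡⟨ cong (λ s → (x + s) % w) (sumMod≡% w xs) ⟩
  (x + sum xs % w) % w        ≡⟨ +-cong {x} {x} {sum xs % w} {sum xs} refl (x%n≈x (sum xs)) ⟩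
  (x + sum xs) % w            ∎
  where
  open ≡-Reasoning
  open Modulo w using (+-cong; x%n≈x)

module DiagonalHeffter
  (p k : ℕ) .{{_ : NonZero p}} (p-prime : Prime p) (k≤p : k ≤ p)
  {γ : ℕ → ℕ} (ordering : SimpleZeroSumHalfSet k γ)
  (a t : ℕ → ℕ)
  (a-unit : ∀ {D} → D < k → 0 < a D × a D < p)
  (p∣∑a : p ∣ ∑< k a)
  (p∣∑aD : p ∣ ∑< k (λ D → a D * D))
  (p∣N+∑t : p ∣ ∑< k γ / suc (k + k) + ∑< k t)
  where

  open SimpleZeroSumHalfSet ordering

  m : ℕ
  m = suc (k + k)

  w : ℕ
  w = p * m

  private instance
    w-nonZero : NonZero w
    w-nonZero = m*n≢0 p m

  u : ℕ → ℕ → ℕ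
  u D r = (a D * r + t D) % p

  entry : ℕ → ℕ → ℕ
  entry D r = γ D + m * u D r

  open DiagonalArray p k k≤p entry public
  open AffineModPrime p p-prime

  entry%m : ∀ {D} r → D < k → entry D r % m ≡ γ D
  entry%m {D} r D<k = begin
    (γ D + m * u D r) % m    ≡⟨ cong (λ x → (γ D + x) % m) (*-comm m (u D r)) ⟩
    (γ D + u D r * m) % m    ≡⟨ [m+kn]%n≡m%n (γ D) (u D r) m ⟩
    γ D % m                  ≡⟨ m<n⇒m%n≡m (proj₂ (γ-range D<k)) ⟩
    γ D                      ∎
    where open ≡-Reasoning

  entry<w : ∀ {D} r → D < k → entry D r < w
  entry<w {D} r D<k = begin-strict
    γ D + m * u D r          <⟨ +-monoˡ-< (m * u D r) (proj₂ (γ-range D<k)) ⟩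
    m + m * u D r            ≡⟨ *-suc m (u D r) ⟨
    m * suc (u D r)          ≤⟨ *-monoʳ-≤ m (m%n<n _ p) ⟩
    m * p                    ≡⟨ *-comm m p ⟩
    w                        ∎
    where open ≤-Reasoning

  entry-injective : ∀ {D D′ r r′} → D < k → D′ < k → r < p → r′ < p →
                    entry D r ≡ entry D′ r′ → D ≡ D′ × r ≡ r′
  entry-injective {D} {D′} {r} {r′} D<k D′<k r<p r′<p eq = D≡D′ , r≡r′
    where
    D≡D′ : D ≡ D′
    D≡D′ = γ-injective D<k D′<k (trans (sym (entry%m r D<k)) (trans (cong (_% m) eq) (entry%m r′ D′<k)))
    u≡u′ : u D r ≡ u D r′
    u≡u′ = *-cancelˡ-≡ (u D r) (u D r′) m
             (+-cancelˡ-≡ (γ D) (m * u D r) (m * u D r′) (trans eq (cong (λ D → entry D r′) (sym D≡D′))))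
    r≡r′ : r ≡ r′
    r≡r′ = affine-injective (t D) (proj₁ (a-unit D<k)) (proj₂ (a-unit D<k)) r<p r′<p u≡u′

  inJ⇒ : ∀ {x} → InJ w p x → x % m ≡ 0
  inJ⇒ {x} inJ = n∣m⇒m%n≡0 x m (*-cancelˡ-∣ p (m%n≡0⇒n∣m (p * x) w (trans (sym (mod≡% w _)) inJ)))

  inJ⇐ : ∀ {x} → x % m ≡ 0 → InJ w p x
  inJ⇐ {x} x%m≡0 = trans (mod≡% w _) (n∣m⇒m%n≡0 (p * x) w (*-monoʳ-∣ p (m%n≡0⇒n∣m x m x%m≡0)))

  entries-outside-J : ∀ x → x ∈ entries array → x < w × (InJ w p x → ⊥)
  entries-outside-J x x∈ with ∈-entries⁻ x∈
  ... | D , r , D<k , r<p , refl =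
    entry<w r D<k , λ inJ → <⇒≢ (proj₁ (γ-range D<k)) (sym (trans (sym (entry%m r D<k)) (inJ⇒ inJ)))

  module _ {x} (x<w : x < w) (x∉J : InJ w p x → ⊥) where

    private
      ρ q : ℕ
      ρ = x % m
      q = x / m
      0<ρ : 0 < ρ
      0<ρ = n≢0⇒n>0 (x∉J ∘ inJ⇐)
      q<p : q < p
      q<p = m<n*o⇒m/o<n x<w

    entry-hits : ∀ {D} → D < k → γ D ≡ ρ → x ∈ entries array
    entry-hits {D} D<k γD≡ρ with affine-surjective (t D) (proj₁ (a-unit D<k)) (proj₂ (a-unit D<k)) q<p
    ... | r , r<p , uDr≡q = subst (_∈ entries array) entry≡x (∈-entries⁺ D<k r<p)
      where
      open ≡-Reasoning
      entry≡x : entry D r ≡ x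
      entry≡x = begin
        γ D + m * u D r      ≡⟨ cong₂ (λ g v → g + m * v) γD≡ρ uDr≡q ⟩
        ρ + m * q            ≡⟨ cong (ρ +_) (*-comm m q) ⟩
        ρ + q * m            ≡⟨ m≡m%n+[m/n]*n x m ⟨
        x                    ∎

    -- w − x = (m − ρ) + m (p − 1 − q)
    entry-hits-negation : ∀ {D} → D < k → γ D ≡ m ∸ ρ → neg w x ∈ entries array
    entry-hits-negation {D} D<k γD≡m∸ρ
      with affine-surjective (t D) (proj₁ (a-unit D<k)) (proj₂ (a-unit D<k)) (∸-monoʳ-< (s≤s z≤n) q<p)
    ... | r , r<p , uDr≡e = subst (_∈ entries array) entry≡-x (∈-entries⁺ D<k r<p)
      where
      open ≡-Reasoning
      e : ℕ
      e = p ∸ suc q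
      rearrange : ∀ ρ q m f e → ρ + q * m + (f + m * e) ≡ (ρ + f) + m * (q + e)
      rearrange = solve-∀
      x+entry≡w : x + entry D r ≡ w
      x+entry≡w = begin
        x + (γ D + m * u D r)
          ≡⟨ cong₂ (λ y g → y + (g + m * u D r)) (m≡m%n+[m/n]*n x m) γD≡m∸ρ ⟩
        ρ + q * m + (m ∸ ρ + m * u D r)      ≡⟨ cong (λ v → ρ + q * m + (m ∸ ρ + m * v)) uDr≡e ⟩
        ρ + q * m + (m ∸ ρ + m * e)          ≡⟨ rearrange ρ q m (m ∸ ρ) e ⟩
        (ρ + (m ∸ ρ)) + m * (q + e)          ≡⟨ cong (_+ m * (q + e)) (m+[n∸m]≡n (<⇒≤ (m%n<n x m))) ⟩
        m + m * (q + e)                      ≡⟨ *-suc m (q + e) ⟨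
        m * (suc q + e)                      ≡⟨ cong (m *_) (m+[n∸m]≡n q<p) ⟩
        m * p                                ≡⟨ *-comm m p ⟩
        w                                    ∎
      entry≡-x : entry D r ≡ neg w x
      entry≡-x = sym (begin
        mod w (w ∸ mod w x)      ≡⟨ mod≡% w _ ⟩
        (w ∸ mod w x) % w        ≡⟨ cong (λ y → (w ∸ y) % w) (trans (mod≡% w x) (m<n⇒m%n≡m x<w)) ⟩
        (w ∸ x) % w              ≡⟨ m<n⇒m%n≡m (∸-monoʳ-< (<-≤-trans 0<ρ (m%n≤m x m)) (<⇒≤ x<w)) ⟩
        w ∸ x                    ≡⟨ cong (_∸ x) x+entry≡w ⟨
        x + entry D r ∸ x        ≡⟨ m+n∸m≡n x (entry D r) ⟩
        entry D r                ∎)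

    entries-cover : x ∈ entries array ⊎ neg w x ∈ entries array
    entries-cover with γ-covers 0<ρ (m%n<n x m)
    ... | D , D<k , inj₁ γD≡ρ   = inj₁ (entry-hits D<k γD≡ρ)
    ... | D , D<k , inj₂ γD≡m∸ρ = inj₂ (entry-hits-negation D<k γD≡m∸ρ)

  halfSet : HalfSet w p (p * k) (entries array)
  halfSet = entries-unique entry-injective , length-entries , entries-outside-J ,
            λ x x<w x∉J → entries-cover x<w x∉J

  private
    open Modulo p using () renaming (_≈_ to _≈ₚ_)

    ∣⇒≈ₚ0 : ∀ {x} → p ∣ x → x ≈ₚ 0
    ∣⇒≈ₚ0 {x} p∣x = trans (n∣m⇒m%n≡0 x p p∣x) (sym (Modulo.0%n≡0 p))

    ∑-entries : ∀ f → ∑< k (λ D → γ D + m * f D) ≡ ∑< k γ + m * ∑< k f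
    ∑-entries f = trans (∑<-+ k γ _) (cong (∑< k γ +_) (∑<-*ˡ k m f))

  -- ∑ γ = N m, so ∑ γ + m U = m (N + U), and p ∣ N + U
  entries-sum≈0 : ∀ U → U ≈ₚ ∑< k t → (∑< k γ + m * U) % w ≡ 0
  entries-sum≈0 U U≈∑t = begin
    (∑< k γ + m * U) % w          ≡⟨ cong (λ s → (s + m * U) % w) (m/n*n≡m m∣∑γ) ⟨
    (N * m + m * U) % w           ≡⟨ cong (_% w) (factor N m U) ⟩
    (m * (N + U)) % w             ≡⟨ cong (λ s → (m * s) % w) (m/n*n≡m p∣N+U) ⟨
    (m * ((N + U) / p * p)) % w   ≡⟨ cong (_% w) (regroup m ((N + U) / p) p) ⟩
    ((N + U) / p * w) % w         ≡⟨ m*n%n≡0 ((N + U) / p) w ⟩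
    0                             ∎
    where
    open ≡-Reasoning
    N : ℕ
    N = ∑< k γ / m
    m∣∑γ : m ∣ ∑< k γ
    m∣∑γ = m%n≡0⇒n∣m (∑< k γ) m sum≡0
    p∣N+U : p ∣ N + U
    p∣N+U = m%n≡0⇒n∣m (N + U) p
              (trans (Modulo.+-cong p {N} {N} {U} {∑< k t} refl U≈∑t) (n∣m⇒m%n≡0 _ p p∣N+∑t))
    factor : ∀ N m U → N * m + m * U ≡ m * (N + U)
    factor = solve-∀
    regroup : ∀ m c p → m * (c * p) ≡ c * (p * m)
    regroup = solve-∀

  row-offsets : ∀ R → ∑< k (λ D → u D R) ≈ₚ ∑< k t
  row-offsets R = begin
    ∑< k (λ D → u D R)
      ≈⟨ ∑<-cong-≈ k (λ {D} _ → x%n≈x (a D * R + t D)) ⟩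
    ∑< k (λ D → a D * R + t D)
      ≡⟨ ∑<-+ k (λ D → a D * R) t ⟩
    ∑< k (λ D → a D * R) + ∑< k t
      ≡⟨ cong (_+ ∑< k t) (trans (∑<-cong k (λ {D} _ → *-comm (a D) R)) (∑<-*ˡ k R a)) ⟩
    R * ∑< k a + ∑< k t
      ≈⟨ +-cong {R * ∑< k a} {R * 0} {∑< k t} {∑< k t}
                (*-cong {R} {R} {∑< k a} {0} refl (∣⇒≈ₚ0 p∣∑a)) refl ⟩
    R * 0 + ∑< k t
      ≡⟨ cong (_+ ∑< k t) (*-zeroʳ R) ⟩
    ∑< k t ∎
    where
    open Modulo p
    open import Relation.Binary.Reasoning.Setoid ≈-setoid

  column-offsets : ∀ C → ∑< k (λ D → u D ((C + D) % p)) ≈ₚ ∑< k t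
  column-offsets C = begin
    ∑< k (λ D → u D ((C + D) % p))
      ≈⟨ ∑<-cong-≈ k (λ {D} _ → reduce D) ⟩
    ∑< k (λ D → C * a D + a D * D + t D)
      ≡⟨ trans (∑<-+ k _ t) (cong (_+ ∑< k t) (trans (∑<-+ k _ _) (cong (_+ ∑< k aD) (∑<-*ˡ k C a)))) ⟩
    C * ∑< k a + ∑< k aD + ∑< k t
      ≈⟨ +-cong {C * ∑< k a + ∑< k aD} {C * 0 + 0} {∑< k t} {∑< k t}
                (+-cong {C * ∑< k a} {C * 0} {∑< k aD} {0} (*-cong {C} {C} {∑< k a} {0} refl (∣⇒≈ₚ0 p∣∑a))
                        (∣⇒≈ₚ0 p∣∑aD))
                refl ⟩
    C * 0 + 0 + ∑< k t
      ≡⟨ cong (λ z → z + 0 + ∑< k t) (*-zeroʳ C) ⟩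
    ∑< k t ∎
    where
    open Modulo p
    open import Relation.Binary.Reasoning.Setoid ≈-setoid
    aD : ℕ → ℕ
    aD D = a D * D
    expand : ∀ a C D t → a * (C + D) + t ≡ C * a + a * D + t
    expand = solve-∀
    reduce : ∀ D → u D ((C + D) % p) ≈ C * a D + a D * D + t D
    reduce D = begin
      u D ((C + D) % p)
        ≈⟨ x%n≈x _ ⟩
      a D * ((C + D) % p) + t D
        ≈⟨ +-cong {a D * ((C + D) % p)} {a D * (C + D)} {t D} {t D}
                  (*-cong {a D} {a D} {(C + D) % p} {C + D} refl (x%n≈x (C + D))) refl ⟩
      a D * (C + D) + t D
        ≡⟨ expand (a D) C D (t D) ⟩
      C * a D + a D * D + t D ∎

  rowList-sum≈0 : ∀ r → sumMod w (rowList array r) ≡ 0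
  rowList-sum≈0 r = begin
    sumMod w (rowList array r)                     ≡⟨ sumMod≡% w (rowList array r) ⟩
    sum (rowList array r) % w                      ≡⟨ cong (_% w) (sum-↭ (Rotation⇒↭ (rowList-rotation r))) ⟨
    ∑< k (λ D → entry D R) % w                     ≡⟨ cong (_% w) (∑-entries (λ D → u D R)) ⟩
    (∑< k γ + m * ∑< k (λ D → u D R)) % w          ≡⟨ entries-sum≈0 _ (row-offsets R) ⟩
    0                                              ∎
    where
    open ≡-Reasoning
    R : ℕ
    R = toℕ r

  colList-sum≈0 : ∀ c → sumMod w (colList array c) ≡ 0
  colList-sum≈0 c = begin
    sumMod w (colList array c)                     ≡⟨ sumMod≡% w (colList array c) ⟩
    sum (colList array c) % w                      ≡⟨ cong (_% w) (sum-↭ (Rotation⇒↭ (colList-rotation c))) ⟨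
    sum (map entryᶜ (upTo k)) % w                  ≡⟨ cong (_% w) (sum-map-upTo k entryᶜ) ⟩
    ∑< k entryᶜ % w                                ≡⟨ cong (_% w) (∑-entries (λ D → u D ((C + D) % p))) ⟩
    (∑< k γ + m * ∑< k (λ D → u D ((C + D) % p))) % w ≡⟨ entries-sum≈0 _ (column-offsets C) ⟩
    0                                              ∎
    where
    open ≡-Reasoning
    C : ℕ
    C = toℕ c
    entryᶜ : ℕ → ℕ
    entryᶜ D = entry D ((C + D) % p)

  open ZeroSumSequences m

  private
    map-residues : ∀ {Ds} (row : ℕ → ℕ) → All (λ D → row D % m ≡ γ D % m) Ds →
                   map (_% m) (map γ Ds) ≡ map (_% m) (map row Ds)
    map-residues {Ds} row same = trans (sym (map-∘ Ds)) (trans (sym (map-cong-local same)) (map-∘ Ds))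

    residue≡γ : ∀ {D} r → D < k → entry D r % m ≡ γ D % m
    residue≡γ r D<k = trans (entry%m r D<k) (sym (m<n⇒m%n≡m (proj₂ (γ-range D<k))))

  rowList-simple : ∀ r → SimpleOrdering w (rowList array r)
  rowList-simple r = zeroSumSimple⇒simpleOrdering w (n∣m*n p)
    (zeroSumSimple-rotation (rowList-rotation r)
      (zeroSumSimple-resp-%
        (map-residues _ (All.tabulate λ D∈ → residue≡γ (toℕ r) (∈-downFrom⁻ D∈)))
        (zeroSumSimple-downFrom sum≡0 prefixSum-injective)))

  colList-simple : ∀ c → SimpleOrdering w (colList array c)
  colList-simple c = zeroSumSimple⇒simpleOrdering w (n∣m*n p)
    (zeroSumSimple-rotation (colList-rotation c)
      (zeroSumSimple-resp-%
        (map-residues _ (All.tabulate λ {D} D∈ → residue≡γ ((toℕ c + D) % p) (∈-upTo⁻ D∈)))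
        (zeroSumSimple-upTo sum≡0 prefixSum-injective)))

  rowList-length : ∀ r → length (rowList array r) ≡ k
  rowList-length r = trans (sym (↭-length (Rotation⇒↭ (rowList-rotation r))))
                           (trans (length-map _ (downFrom k)) (length-downFrom k))

  colList-length : ∀ c → length (colList array c) ≡ k
  colList-length c = trans (sym (↭-length (Rotation⇒↭ (colList-rotation c))))
                           (trans (length-map _ (upTo k)) (length-upTo k))

  HeffterW≡w : HeffterW p k p ≡ w
  HeffterW≡w = expand p k
    where
    expand : ∀ p k → 2 * p * k + p ≡ p * suc (k + k)
    expand = solve-∀

  isHeffter : IsHeffter p k p array
  isHeffter =
    rowList-length , colList-length ,
    subst (λ W → HalfSet W p (p * k) (entries array)) (sym HeffterW≡w) halfSet ,
    subst (λ W → ∀ r → sumMod W (rowList array r) ≡ 0) (sym HeffterW≡w) rowList-sum≈0 ,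
    subst (λ W → ∀ c → sumMod W (colList array c) ≡ 0) (sym HeffterW≡w) colList-sum≈0

  globallySimple : GloballySimple (HeffterW p k p) array
  globallySimple =
    subst (λ W → GloballySimple W array) (sym HeffterW≡w) (rowList-simple , colList-simple)

-- A zero-sum simple ordering of a half-set of ℤ_{2k+1}

data Parity : ℕ → Set where
  even : ∀ h → Parity (h + h)
  odd  : ∀ h → Parity (suc (h + h))

parity : ∀ n → Parity n
parity zero    = even 0
parity (suc n) with parity n
... | even h = odd h
... | odd h  = subst Parity (cong suc (+-suc h h)) (even (suc h))

m+m≤n+n⇒m≤n : ∀ {m n} → m + m ≤ n + n → m ≤ n
m+m≤n+n⇒m≤n {m} {n} m+m≤n+n with ≤-<-connex m n
... | inj₁ m≤n = m≤n
... | inj₂ n<m = ⊥-elim (<⇒≱ (+-mono-< n<m n<m) m+m≤n+n)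

m∸[n+o]+n≡m∸o : ∀ {m n o} → n + o ≤ m → m ∸ (n + o) + n ≡ m ∸ o
m∸[n+o]+n≡m∸o {m} {n} {o} n+o≤m = begin
  m ∸ (n + o) + n    ≡⟨ cong (λ z → m ∸ z + n) (+-comm n o) ⟩
  m ∸ (o + n) + n    ≡⟨ cong (_+ n) (∸-+-assoc m o n) ⟨
  m ∸ o ∸ n + n      ≡⟨ m∸n+n≡m (m+n≤o⇒m≤o∸n n n+o≤m) ⟩
  m ∸ o              ∎
  where open ≡-Reasoning

module SignedMagnitudes {k : ℕ} (C γ : ℕ → ℕ)
  (C-range      : ∀ {i} → i < k → 0 < C i × C i ≤ k)
  (C-injective  : ∀ {i j} → i < k → j < k → C i ≡ C j → i ≡ j)
  (C-surjective : ∀ {y} → 0 < y → y ≤ k → ∃[ i ] i < k × C i ≡ y)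
  (γ-signed     : ∀ {i} → i < k → γ i ≡ C i ⊎ γ i ≡ suc (k + k) ∸ C i)
  where

  private
    m : ℕ
    m = suc (k + k)

    C<m : ∀ {i} → i < k → C i < m
    C<m i<k = s≤s (≤-trans (proj₂ (C-range i<k)) (m≤m+n k k))

    no-wrap : ∀ {i j} → i < k → j < k → C i ≢ m ∸ C j
    no-wrap {i} {j} i<k j<k Ci≡m∸Cj =
      <⇒≢ (s≤s (+-mono-≤ (proj₂ (C-range i<k)) (proj₂ (C-range j<k))))
          (trans (cong (_+ C j) Ci≡m∸Cj) (m∸n+n≡m (<⇒≤ (C<m j<k))))

  γ-range : ∀ {i} → i < k → 0 < γ i × γ i < m
  γ-range {i} i<k with γ-signed i<k
  ... | inj₁ γi≡Ci   = subst (λ g → 0 < g × g < m) (sym γi≡Ci) (proj₁ (C-range i<k) , C<m i<k)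
  ... | inj₂ γi≡m∸Ci = subst (λ g → 0 < g × g < m) (sym γi≡m∸Ci)
                         (m<n⇒0<n∸m (C<m i<k) , ∸-monoʳ-< (proj₁ (C-range i<k)) (<⇒≤ (C<m i<k)))

  γ-injective : ∀ {i j} → i < k → j < k → γ i ≡ γ j → i ≡ j
  γ-injective {i} {j} i<k j<k γi≡γj with γ-signed i<k | γ-signed j<k
  ... | inj₁ γi≡Ci   | inj₁ γj≡Cj   = C-injective i<k j<k (trans (sym γi≡Ci) (trans γi≡γj γj≡Cj))
  ... | inj₂ γi≡m∸Ci | inj₂ γj≡m∸Cj = C-injective i<k j<k
    (∸-cancelˡ-≡ (<⇒≤ (C<m i<k)) (<⇒≤ (C<m j<k)) (trans (sym γi≡m∸Ci) (trans γi≡γj γj≡m∸Cj)))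
  ... | inj₁ γi≡Ci   | inj₂ γj≡m∸Cj =
    ⊥-elim (no-wrap i<k j<k (trans (sym γi≡Ci) (trans γi≡γj γj≡m∸Cj)))
  ... | inj₂ γi≡m∸Ci | inj₁ γj≡Cj   =
    ⊥-elim (no-wrap j<k i<k (trans (sym γj≡Cj) (trans (sym γi≡γj) γi≡m∸Ci)))

  γ-covers : ∀ {x} → 0 < x → x < m → ∃[ i ] i < k × (γ i ≡ x ⊎ γ i ≡ m ∸ x)
  γ-covers {x} 0<x x<m with x ≤? k
  ... | yes x≤k = covers-small (C-surjective 0<x x≤k)
    where
    covers-small : ∃[ i ] i < k × C i ≡ x → ∃[ i ] i < k × (γ i ≡ x ⊎ γ i ≡ m ∸ x)
    covers-small (i , i<k , Ci≡x) with γ-signed i<k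
    ... | inj₁ γi≡Ci   = i , i<k , inj₁ (trans γi≡Ci Ci≡x)
    ... | inj₂ γi≡m∸Ci = i , i<k , inj₂ (trans γi≡m∸Ci (cong (m ∸_) Ci≡x))
  ... | no x≰k = covers-large (C-surjective (m<n⇒0<n∸m x<m) m∸x≤k)
    where
    m∸x≤k : m ∸ x ≤ k
    m∸x≤k = ≤-trans (∸-monoʳ-≤ m (≰⇒> x≰k)) (≤-reflexive (m+n∸m≡n (suc k) k))
    covers-large : ∃[ i ] i < k × C i ≡ m ∸ x → ∃[ i ] i < k × (γ i ≡ x ⊎ γ i ≡ m ∸ x)
    covers-large (i , i<k , Ci≡m∸x) with γ-signed i<k
    ... | inj₁ γi≡Ci   = i , i<k , inj₂ (trans γi≡Ci Ci≡m∸x)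
    ... | inj₂ γi≡m∸Ci =
      i , i<k , inj₁ (trans γi≡m∸Ci (trans (cong (m ∸_) Ci≡m∸x) (m∸[m∸n]≡n (<⇒≤ x<m))))

-- k = 2h + 1 or 2h + 2, and the skipped magnitude v = g + g is the even one of h + 1, h + 2.
record SequenceShape (k : ℕ) : Set where
  field
    h g δ   : ℕ
    k-shape : k ≡ suc (h + h) ⊎ k ≡ suc (suc (h + h))
    v≡      : g + g ≡ suc h + δ
    δ≤1     : δ ≤ 1
    1≤h     : 1 ≤ h
    v<k     : g + g < k

private
  shape-from-half : ∀ {k} h → k ≡ suc (h + h) ⊎ k ≡ suc (suc (h + h)) → 1 ≤ h → SequenceShape k
  shape-from-half {k} h k-shape 1≤h = from-parity (parity (suc h)) refl
    where
    2h<k : h + h < k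
    2h<k = below k-shape
      where
      below : k ≡ suc (h + h) ⊎ k ≡ suc (suc (h + h)) → h + h < k
      below (inj₁ refl) = n<1+n (h + h)
      below (inj₂ refl) = <-trans (n<1+n (h + h)) (n<1+n (suc (h + h)))
    from-parity : ∀ {n} → Parity n → n ≡ suc h → SequenceShape k
    from-parity (even g) 2g≡1+h = record
      { h = h ; g = g ; δ = 0 ; k-shape = k-shape
      ; v≡ = trans 2g≡1+h (sym (+-identityʳ (suc h)))
      ; δ≤1 = z≤n ; 1≤h = 1≤h
      ; v<k = subst (_< k) (sym 2g≡1+h) (≤-<-trans (+-monoˡ-≤ h 1≤h) 2h<k)
      }
    from-parity (odd g) 1+2g≡1+h = record
      { h = h ; g = suc g ; δ = 1 ; k-shape = k-shape
      ; v≡ = trans v≡2+h (cong suc (+-comm 1 h))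
      ; δ≤1 = ≤-refl ; 1≤h = 1≤h
      ; v<k = subst (_< k) (sym v≡2+h) (≤-<-trans (+-monoˡ-≤ h 2≤h) 2h<k)
      }
      where
      2g≡h : g + g ≡ h
      2g≡h = suc-injective 1+2g≡1+h
      v≡2+h : suc g + suc g ≡ suc (suc h)
      v≡2+h = trans (cong suc (+-suc g g)) (cong (suc ∘ suc) 2g≡h)
      positive : ∀ g → g + g ≡ h → 1 ≤ g
      positive zero    0≡h = subst (1 ≤_) (sym 0≡h) 1≤h
      positive (suc _) _   = s≤s z≤n
      2≤h : 2 ≤ h
      2≤h = subst (2 ≤_) 2g≡h (+-mono-≤ (positive g 2g≡h) (positive g 2g≡h))

sequenceShape : ∀ k → 3 ≤ k → SequenceShape k
sequenceShape (suc k′) (s≤s 2≤k′) with parity k′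
... | even h = shape-from-half h (inj₁ refl) (m+m≤n+n⇒m≤n 2≤k′)
... | odd h  = shape-from-half h (inj₂ refl) (positive-half h (≤-pred 2≤k′))
  where
  positive-half : ∀ h → 1 ≤ h + h → 1 ≤ h
  positive-half (suc _) _ = s≤s z≤n

-- γ i = ± step i with the signs +, −, +, −, …; the magnitudes run through
-- 1, …, v − 1, v + 1, …, k and end with v. When δ = 1 the second to last step is
-- k + 1 ≡ −k instead of k, which flips that sign. The partial sums alternate between
-- the points −depth t (after 2t steps) and oddPoint t (after 2t + 1 steps).
module AlternatingSequence {k h g δ : ℕ}
  (k-shape : k ≡ suc (h + h) ⊎ k ≡ suc (suc (h + h)))
  (v≡ : g + g ≡ suc h + δ)
  (δ≤1 : δ ≤ 1)
  (1≤h : 1 ≤ h)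
  (v<k : g + g < k)
  where

  m : ℕ
  m = suc (k + k)

  v : ℕ
  v = g + g

  passed : ℕ → ℕ
  passed n = if does (v ≤? n) then 1 else 0

  δ-at : ℕ → ℕ
  δ-at n = if does (n ≟ k) then δ else 0

  skip : ℕ → ℕ
  skip n = n + passed n

  magnitude : ℕ → ℕ
  magnitude i = if does (suc i ≟ k) then v else skip (suc i)

  step : ℕ → ℕ
  step i = magnitude i + δ-at (suc (suc i))

  signed : ℕ → ℕ → ℕ
  signed zero          x = x
  signed (suc zero)    x = m ∸ x
  signed (suc (suc i)) x = signed i x

  γ : ℕ → ℕ
  γ i = signed i (step i)

  depth : ℕ → ℕ
  depth t = t + passed (t + t) + δ-at (suc (t + t))

  evenPoint : ℕ → ℕ
  evenPoint t = m ∸ depth t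

  oddPoint : ℕ → ℕ
  oddPoint t = suc t + δ-at (suc (suc (t + t)))

  k≤m : k ≤ m
  k≤m = ≤-trans (m≤m+n k k) (n≤1+n _)

  m∸k≡1+k : m ∸ k ≡ suc k
  m∸k≡1+k = trans (cong (_∸ k) (sym (+-suc k k))) (m+n∸m≡n k (suc k))

  3≤k : 3 ≤ k
  3≤k = from-shape k-shape
    where
    from-shape : k ≡ suc (h + h) ⊎ k ≡ suc (suc (h + h)) → 3 ≤ k
    from-shape (inj₁ refl) = s≤s (+-mono-≤ 1≤h 1≤h)
    from-shape (inj₂ refl) = s≤s (s≤s (≤-trans 1≤h (m≤m+n h h)))

  2≤v : 2 ≤ v
  2≤v = subst (2 ≤_) (sym v≡) (s≤s (≤-trans 1≤h (m≤m+n h δ)))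

  passed-≥ : ∀ {n} → v ≤ n → passed n ≡ 1
  passed-≥ {n} v≤n rewrite dec-true (v ≤? n) v≤n = refl

  passed-< : ∀ {n} → n < v → passed n ≡ 0
  passed-< {n} n<v rewrite dec-false (v ≤? n) (<⇒≱ n<v) = refl

  passed≤1 : ∀ n → passed n ≤ 1
  passed≤1 n with does (v ≤? n)
  ... | true  = ≤-refl
  ... | false = z≤n

  passed-mono : ∀ {n n′} → n ≤ n′ → passed n ≤ passed n′
  passed-mono {n} {n′} n≤n′ with v ≤? n
  ... | yes v≤n rewrite passed-≥ v≤n | passed-≥ (≤-trans v≤n n≤n′) = ≤-refl
  ... | no v≰n  rewrite passed-< (≰⇒> v≰n) = z≤n

  -- because v is even
  passed-odd : ∀ t → passed (suc (t + t)) ≡ passed (t + t)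
  passed-odd t with v ≤? t + t
  ... | yes v≤2t = trans (passed-≥ (m≤n⇒m≤1+n v≤2t)) (sym (passed-≥ v≤2t))
  ... | no v≰2t  = trans (passed-< 1+2t<v) (sym (passed-< (≰⇒> v≰2t)))
    where
    t<g : t < g
    t<g = ≰⇒> (λ g≤t → v≰2t (+-mono-≤ g≤t g≤t))
    1+2t<v : suc (t + t) < v
    1+2t<v = subst (_≤ v) (cong suc (+-suc t t)) (+-mono-≤ t<g t<g)

  δ-at-≢ : ∀ {n} → n ≢ k → δ-at n ≡ 0
  δ-at-≢ {n} n≢k rewrite dec-false (n ≟ k) n≢k = refl

  δ-at-k : δ-at k ≡ δ
  δ-at-k rewrite dec-true (k ≟ k) refl = refl

  δ-at≤1 : ∀ n → δ-at n ≤ 1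
  δ-at≤1 n with does (n ≟ k)
  ... | true  = δ≤1
  ... | false = z≤n

  signed-even : ∀ t x → signed (t + t) x ≡ x
  signed-even zero    x = refl
  signed-even (suc t) x rewrite +-suc t t = signed-even t x

  signed-odd : ∀ t x → signed (suc (t + t)) x ≡ m ∸ x
  signed-odd zero    x = refl
  signed-odd (suc t) x rewrite +-suc t t = signed-odd t x

  signed-cases : ∀ i x → signed i x ≡ x ⊎ signed i x ≡ m ∸ x
  signed-cases zero          x = inj₁ refl
  signed-cases (suc zero)    x = inj₂ refl
  signed-cases (suc (suc i)) x = signed-cases i x

  magnitude-last : ∀ {i} → suc i ≡ k → magnitude i ≡ v
  magnitude-last {i} 1+i≡k rewrite dec-true (suc i ≟ k) 1+i≡k = refl

  magnitude-skip : ∀ {i} → suc i < k → magnitude i ≡ skip (suc i)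
  magnitude-skip {i} 1+i<k rewrite dec-false (suc i ≟ k) (<⇒≢ 1+i<k) = refl

  magnitude-range : ∀ {i} → i < k → 0 < magnitude i × magnitude i ≤ k
  magnitude-range {i} i<k with m≤n⇒m<n∨m≡n i<k
  ... | inj₂ 1+i≡k rewrite magnitude-last 1+i≡k = <-≤-trans (s≤s z≤n) 2≤v , <⇒≤ v<k
  ... | inj₁ 1+i<k rewrite magnitude-skip 1+i<k =
    s≤s z≤n ,
    ≤-trans (+-monoʳ-≤ (suc i) (passed≤1 (suc i))) (≤-trans (≤-reflexive (+-comm (suc i) 1)) 1+i<k)

  step≤m : ∀ {i} → i < k → step i ≤ m
  step≤m {i} i<k = begin
    magnitude i + δ-at (suc (suc i))  ≤⟨ +-mono-≤ (proj₂ (magnitude-range i<k)) (δ-at≤1 (suc (suc i))) ⟩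
    k + 1                             ≡⟨ +-comm k 1 ⟩
    suc k                             ≤⟨ s≤s (m≤m+n k k) ⟩
    m                                 ∎
    where open ≤-Reasoning

  step-even : ∀ t → suc (t + t) < k → step (t + t) ≡ depth t + oddPoint t
  step-even t 1+2t<k = begin
    magnitude (t + t) + δ-at (suc (suc (t + t)))
      ≡⟨ cong (_+ δ-at (suc (suc (t + t)))) (magnitude-skip 1+2t<k) ⟩
    suc (t + t) + passed (suc (t + t)) + δ-at (suc (suc (t + t)))
      ≡⟨ cong (λ P → suc (t + t) + P + δ-at (suc (suc (t + t)))) (passed-odd t) ⟩
    suc (t + t) + passed (t + t) + δ-at (suc (suc (t + t)))
      ≡⟨ rearrange t (passed (t + t)) (δ-at (suc (suc (t + t)))) ⟩
    t + passed (t + t) + 0 + (suc t + δ-at (suc (suc (t + t))))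
      ≡⟨ cong (λ d → t + passed (t + t) + d + oddPoint t) (δ-at-≢ (<⇒≢ 1+2t<k)) ⟨
    depth t + oddPoint t ∎
    where
    open ≡-Reasoning
    rearrange : ∀ t P d → suc (t + t) + P + d ≡ t + P + 0 + (suc t + d)
    rearrange = solve-∀

  step-odd : ∀ t → suc (suc (t + t)) < k → step (suc (t + t)) ≡ oddPoint t + depth (suc t)
  step-odd t 2+2t<k = begin
    magnitude (suc (t + t)) + δ-at (suc (suc (suc (t + t))))
      ≡⟨ cong (_+ δ-at (suc (suc (suc (t + t))))) (magnitude-skip 2+2t<k) ⟩
    suc (suc (t + t)) + passed (suc (suc (t + t))) + δ-at (suc (suc (suc (t + t))))
      ≡⟨ rearrange t (passed (suc (suc (t + t)))) (δ-at (suc (suc (suc (t + t))))) ⟩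
    suc t + 0 + (suc t + passed (suc (suc (t + t))) + δ-at (suc (suc (suc (t + t)))))
      ≡⟨ cong₂ (λ d n → suc t + d + (suc t + passed n + δ-at (suc n)))
               (δ-at-≢ (<⇒≢ 2+2t<k)) (cong suc (+-suc t t)) ⟨
    oddPoint t + depth (suc t) ∎
    where
    open ≡-Reasoning
    rearrange : ∀ t P d → suc (suc (t + t)) + P + d ≡ suc t + 0 + (suc t + P + d)
    rearrange = solve-∀

  t+2≤k : ∀ t → t + t < k → t + 2 ≤ k
  t+2≤k t 2t<k = m+m≤n+n⇒m≤n (begin
    t + 2 + (t + 2)     ≡⟨ rearrange t ⟩
    suc (t + t) + 3     ≤⟨ +-mono-≤ 2t<k 3≤k ⟩
    k + k               ∎)
    where
    open ≤-Reasoning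
    rearrange : ∀ t → t + 2 + (t + 2) ≡ suc (t + t) + 3
    rearrange = solve-∀

  depth≤k : ∀ t → t + t < k → depth t ≤ k
  depth≤k t 2t<k = begin
    t + passed (t + t) + δ-at (suc (t + t))
      ≤⟨ +-mono-≤ (+-monoʳ-≤ t (passed≤1 (t + t))) (δ-at≤1 (suc (t + t))) ⟩
    t + 1 + 1
      ≡⟨ +-assoc t 1 1 ⟩
    t + 2
      ≤⟨ t+2≤k t 2t<k ⟩
    k ∎
    where open ≤-Reasoning

  depth-zero : depth 0 ≡ 0
  depth-zero =
    cong₂ _+_ (passed-< (<-≤-trans (s≤s z≤n) 2≤v)) (δ-at-≢ (<⇒≢ (≤-trans (s≤s (s≤s z≤n)) 3≤k)))

  private
    double-< : ∀ {t t′} → t < t′ → suc (t + t) < t′ + t′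
    double-< {t} {t′} t<t′ = subst (_≤ t′ + t′) (cong suc (+-suc t t)) (+-mono-≤ t<t′ t<t′)

  depth-strict : ∀ {t t′} → t < t′ → t′ + t′ < k → depth t < depth t′
  depth-strict {t} {t′} t<t′ 2t′<k = begin-strict
    t + passed (t + t) + δ-at (suc (t + t))
      ≡⟨ cong (t + passed (t + t) +_) (δ-at-≢ (<⇒≢ (<-trans (double-< t<t′) 2t′<k))) ⟩
    t + passed (t + t) + 0
      ≡⟨ +-identityʳ _ ⟩
    t + passed (t + t)
      <⟨ +-mono-<-≤ t<t′ (passed-mono (+-mono-≤ (<⇒≤ t<t′) (<⇒≤ t<t′))) ⟩
    t′ + passed (t′ + t′)
      ≤⟨ m≤m+n _ _ ⟩
    depth t′ ∎
    where open ≤-Reasoning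

  oddPoint-strict : ∀ {t t′} → t < t′ → suc (t′ + t′) < k → oddPoint t < oddPoint t′
  oddPoint-strict {t} {t′} t<t′ 1+2t′<k = begin-strict
    suc t + δ-at (suc (suc (t + t)))
      ≡⟨ cong (suc t +_)
              (δ-at-≢ (<⇒≢ (≤-<-trans (double-< t<t′) (<-trans (n<1+n _) 1+2t′<k)))) ⟩
    suc t + 0
      ≡⟨ +-identityʳ _ ⟩
    suc t
      <⟨ s≤s t<t′ ⟩
    suc t′
      ≤⟨ m≤m+n _ _ ⟩
    oddPoint t′ ∎
    where open ≤-Reasoning

  depth-injective : ∀ {t t′} → t + t < k → t′ + t′ < k → depth t ≡ depth t′ → t ≡ t′
  depth-injective {t} {t′} 2t<k 2t′<k eq with <-cmp t t′
  ... | tri< t<t′ _ _ = ⊥-elim (<⇒≢ (depth-strict t<t′ 2t′<k) eq)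
  ... | tri≈ _ t≡t′ _ = t≡t′
  ... | tri> _ _ t′<t = ⊥-elim (<⇒≢ (depth-strict t′<t 2t<k) (sym eq))

  oddPoint-injective : ∀ {t t′} → suc (t + t) < k → suc (t′ + t′) < k →
                       oddPoint t ≡ oddPoint t′ → t ≡ t′
  oddPoint-injective {t} {t′} 1+2t<k 1+2t′<k eq with <-cmp t t′
  ... | tri< t<t′ _ _ = ⊥-elim (<⇒≢ (oddPoint-strict t<t′ 1+2t′<k) eq)
  ... | tri≈ _ t≡t′ _ = t≡t′
  ... | tri> _ _ t′<t = ⊥-elim (<⇒≢ (oddPoint-strict t′<t 1+2t<k) (sym eq))

  evenPoint-range : ∀ t → t + t < k → k < evenPoint t × evenPoint t ≤ m
  evenPoint-range t 2t<k =
    ≤-trans (≤-reflexive (sym m∸k≡1+k)) (∸-monoʳ-≤ m (depth≤k t 2t<k)) , m∸n≤m m (depth t)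

  oddPoint-range : ∀ t → suc (t + t) < k → 0 < oddPoint t × oddPoint t ≤ k
  oddPoint-range t 1+2t<k = s≤s z≤n , (begin
    suc t + δ-at (suc (suc (t + t)))   ≤⟨ +-monoʳ-≤ (suc t) (δ-at≤1 (suc (suc (t + t)))) ⟩
    suc t + 1                          ≡⟨ +-suc t 1 ⟨
    t + 2                              ≤⟨ t+2≤k t (<-trans (n<1+n _) 1+2t<k) ⟩
    k                                  ∎)
    where open ≤-Reasoning

  private
    S : ℕ → ℕ
    S n = ∑< n γ

    open Modulo m using (+-cong)

  prefixSum-even : ∀ t → t + t < k → S (t + t) % m ≡ evenPoint t % m
  prefixSum-odd  : ∀ t → suc (t + t) < k → S (suc (t + t)) % m ≡ oddPoint t % m

  prefixSum-even zero    _    = trans (sym (n%n≡0 m)) (cong (λ x → (m ∸ x) % m) (sym depth-zero))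
  prefixSum-even (suc t) 2t<k = begin
    S (suc t + suc t) % m
      ≡⟨ cong (λ n → S n % m) (cong suc (+-suc t t)) ⟩
    (γ (suc (t + t)) + S (suc (t + t))) % m
      ≡⟨ cong (λ x → (x + S (suc (t + t))) % m) (signed-odd t (step (suc (t + t)))) ⟩
    (m ∸ step (suc (t + t)) + S (suc (t + t))) % m
      ≡⟨ +-cong {m ∸ step (suc (t + t))} {m ∸ step (suc (t + t))} {S (suc (t + t))} {oddPoint t}
                refl (prefixSum-odd t 1+2t<k) ⟩
    (m ∸ step (suc (t + t)) + oddPoint t) % m
      ≡⟨ cong (λ x → (m ∸ x + oddPoint t) % m) (step-odd t 2+2t<k) ⟩
    (m ∸ (oddPoint t + depth (suc t)) + oddPoint t) % m
      ≡⟨ cong (_% m) (m∸[n+o]+n≡m∸o {n = oddPoint t} {o = depth (suc t)}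
                        (subst (_≤ m) (step-odd t 2+2t<k) (step≤m 1+2t<k))) ⟩
    evenPoint (suc t) % m ∎
    where
    open ≡-Reasoning
    2+2t<k : suc (suc (t + t)) < k
    2+2t<k = subst (_< k) (cong suc (+-suc t t)) 2t<k
    1+2t<k : suc (t + t) < k
    1+2t<k = <-trans (n<1+n _) 2+2t<k

  prefixSum-odd t 1+2t<k = begin
    (γ (t + t) + S (t + t)) % m
      ≡⟨ cong (λ x → (x + S (t + t)) % m) (signed-even t (step (t + t))) ⟩
    (step (t + t) + S (t + t)) % m
      ≡⟨ +-cong {step (t + t)} {step (t + t)} {S (t + t)} {evenPoint t} refl (prefixSum-even t 2t<k) ⟩
    (step (t + t) + (m ∸ depth t)) % m
      ≡⟨ cong (λ x → (x + (m ∸ depth t)) % m) (step-even t 1+2t<k) ⟩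
    (depth t + oddPoint t + (m ∸ depth t)) % m
      ≡⟨ cong (_% m) (rearrange (depth t) (oddPoint t) (m ∸ depth t)) ⟩
    (oddPoint t + (m ∸ depth t + depth t)) % m
      ≡⟨ cong (λ x → (oddPoint t + x) % m) (m∸n+n≡m (≤-trans (depth≤k t 2t<k) k≤m)) ⟩
    (oddPoint t + m) % m
      ≡⟨ [m+n]%n≡m%n (oddPoint t) m ⟩
    oddPoint t % m ∎
    where
    open ≡-Reasoning
    2t<k : t + t < k
    2t<k = <-trans (n<1+n _) 1+2t<k
    rearrange : ∀ x o y → x + o + y ≡ o + (y + x)
    rearrange = solve-∀

  private
    v≤m : v ≤ m
    v≤m = ≤-trans (<⇒≤ v<k) k≤m

  prefixSum-total-odd : k ≡ suc (h + h) → S k % m ≡ 0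
  prefixSum-total-odd refl = begin
    (γ (h + h) + S (h + h)) % m
      ≡⟨ cong (λ x → (x + S (h + h)) % m) (trans (signed-even h _) last-step) ⟩
    (v + S (h + h)) % m
      ≡⟨ +-cong {v} {v} {S (h + h)} {evenPoint h} refl (prefixSum-even h (n<1+n _)) ⟩
    (v + (m ∸ depth h)) % m
      ≡⟨ cong (λ x → (v + (m ∸ x)) % m) depth≡v ⟩
    (v + (m ∸ v)) % m
      ≡⟨ cong (_% m) (m+[n∸m]≡n v≤m) ⟩
    m % m
      ≡⟨ n%n≡0 m ⟩
    0 ∎
    where
    open ≡-Reasoning
    last-step : step (h + h) ≡ v
    last-step = trans (cong₂ _+_ (magnitude-last refl) (δ-at-≢ (<⇒≢ (n<1+n _) ∘ sym))) (+-identityʳ v)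
    depth≡v : depth h ≡ v
    depth≡v = begin
      h + passed (h + h) + δ-at (suc (h + h))
        ≡⟨ cong₂ (λ P d → h + P + d) (passed-≥ (≤-pred v<k)) δ-at-k ⟩
      h + 1 + δ
        ≡⟨ cong (_+ δ) (+-comm h 1) ⟩
      suc h + δ
        ≡⟨ v≡ ⟨
      v ∎

  prefixSum-total-even : k ≡ suc (suc (h + h)) → S k % m ≡ 0
  prefixSum-total-even refl = begin
    (γ (suc (h + h)) + S (suc (h + h))) % m
      ≡⟨ cong (λ x → (x + S (suc (h + h))) % m) (trans (signed-odd h _) (cong (m ∸_) last-step)) ⟩
    (m ∸ v + S (suc (h + h))) % m
      ≡⟨ +-cong {m ∸ v} {m ∸ v} {S (suc (h + h))} {oddPoint h} refl (prefixSum-odd h (n<1+n _)) ⟩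
    (m ∸ v + oddPoint h) % m
      ≡⟨ cong (λ x → (m ∸ v + x) % m) (trans (cong (suc h +_) δ-at-k) (sym v≡)) ⟩
    (m ∸ v + v) % m
      ≡⟨ cong (_% m) (m∸n+n≡m v≤m) ⟩
    m % m
      ≡⟨ n%n≡0 m ⟩
    0 ∎
    where
    open ≡-Reasoning
    last-step : step (suc (h + h)) ≡ v
    last-step = trans (cong₂ _+_ (magnitude-last refl) (δ-at-≢ (<⇒≢ (n<1+n _) ∘ sym))) (+-identityʳ v)

  prefixSum-total : S k % m ≡ 0
  prefixSum-total = [ prefixSum-total-odd , prefixSum-total-even ]′ k-shape

  private
    point-≡ : ∀ {x y} → 0 < x × x ≤ m → 0 < y × y ≤ m → x % m ≡ y % m → x ≡ y
    point-≡ (0<x , x≤m) (0<y , y≤m) = Modulo.≈-window⇒≡ m 0<x (s≤s x≤m) 0<y (s≤s y≤m)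

    even-bounds : ∀ t → t + t < k → 0 < evenPoint t × evenPoint t ≤ m
    even-bounds t 2t<k = ≤-<-trans z≤n (proj₁ (evenPoint-range t 2t<k)) , proj₂ (evenPoint-range t 2t<k)

    odd-bounds : ∀ t → suc (t + t) < k → 0 < oddPoint t × oddPoint t ≤ m
    odd-bounds t 1+2t<k = proj₁ (oddPoint-range t 1+2t<k) , ≤-trans (proj₂ (oddPoint-range t 1+2t<k)) k≤m

    prefixSum-even≢odd : ∀ t t′ → t + t < k → suc (t′ + t′) < k →
                         S (t + t) % m ≢ S (suc (t′ + t′)) % m
    prefixSum-even≢odd t t′ 2t<k 1+2t′<k eq =
      <⇒≢ (≤-<-trans (proj₂ (oddPoint-range t′ 1+2t′<k)) (proj₁ (evenPoint-range t 2t<k)))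
        (sym (point-≡ (even-bounds t 2t<k) (odd-bounds t′ 1+2t′<k)
               (trans (sym (prefixSum-even t 2t<k)) (trans eq (prefixSum-odd t′ 1+2t′<k)))))

  -- Distinct points of [1, m] are incongruent; the even points exceed k, the odd ones do not.
  prefixSum-injective : ∀ {i j} → i < k → j < k → S i % m ≡ S j % m → i ≡ j
  prefixSum-injective {i} {j} i<k j<k Si≈Sj with parity i | parity j
  ... | even t | even t′ = cong (λ s → s + s) (depth-injective i<k j<k
          (∸-cancelˡ-≡ (≤-trans (depth≤k t i<k) k≤m) (≤-trans (depth≤k t′ j<k) k≤m)
            (point-≡ (even-bounds t i<k) (even-bounds t′ j<k)
              (trans (sym (prefixSum-even t i<k)) (trans Si≈Sj (prefixSum-even t′ j<k))))))
  ... | odd t  | odd t′  = cong (λ s → suc (s + s)) (oddPoint-injective i<k j<k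
          (point-≡ (odd-bounds t i<k) (odd-bounds t′ j<k)
            (trans (sym (prefixSum-odd t i<k)) (trans Si≈Sj (prefixSum-odd t′ j<k)))))
  ... | even t | odd t′  = ⊥-elim (prefixSum-even≢odd t t′ i<k j<k Si≈Sj)
  ... | odd t  | even t′ = ⊥-elim (prefixSum-even≢odd t′ t j<k i<k (sym Si≈Sj))

  skip-strict : ∀ {n n′} → n < n′ → skip n < skip n′
  skip-strict n<n′ = +-mono-<-≤ n<n′ (passed-mono (<⇒≤ n<n′))

  skip-injective : ∀ {n n′} → skip n ≡ skip n′ → n ≡ n′
  skip-injective {n} {n′} eq with <-cmp n n′
  ... | tri< n<n′ _ _ = ⊥-elim (<⇒≢ (skip-strict n<n′) eq)
  ... | tri≈ _ n≡n′ _ = n≡n′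
  ... | tri> _ _ n′<n = ⊥-elim (<⇒≢ (skip-strict n′<n) (sym eq))

  skip≢v : ∀ n → skip n ≢ v
  skip≢v n with v ≤? n
  ... | yes v≤n rewrite passed-≥ v≤n =
    λ n+1≡v → <⇒≢ (≤-<-trans v≤n (m<m+n n (s≤s z≤n))) (sym n+1≡v)
  ... | no v≰n  rewrite passed-< (≰⇒> v≰n) =
    λ n+0≡v → <⇒≢ (≰⇒> v≰n) (trans (sym (+-identityʳ n)) n+0≡v)

  magnitude-injective : ∀ {i j} → i < k → j < k → magnitude i ≡ magnitude j → i ≡ j
  magnitude-injective {i} {j} i<k j<k eq with m≤n⇒m<n∨m≡n i<k | m≤n⇒m<n∨m≡n j<k
  ... | inj₂ 1+i≡k | inj₂ 1+j≡k = suc-injective (trans 1+i≡k (sym 1+j≡k))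
  ... | inj₂ 1+i≡k | inj₁ 1+j<k =
    ⊥-elim (skip≢v (suc j) (trans (sym (magnitude-skip 1+j<k)) (trans (sym eq) (magnitude-last 1+i≡k))))
  ... | inj₁ 1+i<k | inj₂ 1+j≡k =
    ⊥-elim (skip≢v (suc i) (trans (sym (magnitude-skip 1+i<k)) (trans eq (magnitude-last 1+j≡k))))
  ... | inj₁ 1+i<k | inj₁ 1+j<k =
    suc-injective (skip-injective (trans (sym (magnitude-skip 1+i<k)) (trans eq (magnitude-skip 1+j<k))))

  magnitude-surjective : ∀ {y} → 0 < y → y ≤ k → ∃[ i ] i < k × magnitude i ≡ y
  magnitude-surjective {suc y} _ 1+y≤k with <-cmp (suc y) v
  ... | tri< 1+y<v _ _ = y , 1+y≤k ,
    trans (magnitude-skip (<-trans 1+y<v v<k)) (trans (cong (suc y +_) (passed-< 1+y<v)) (+-identityʳ (suc y)))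
  ... | tri≈ _ 1+y≡v _ =
    pred k , <-≤-trans (n<1+n (pred k)) (≤-reflexive k≡) , trans (magnitude-last k≡) (sym 1+y≡v)
    where
    k≡ : suc (pred k) ≡ k
    k≡ = suc-pred k {{>-nonZero (<-≤-trans (s≤s z≤n) 3≤k)}}
  ... | tri> _ _ v<1+y = above y v<1+y 1+y≤k
    where
    above : ∀ y → v < suc y → suc y ≤ k → ∃[ i ] i < k × magnitude i ≡ suc y
    above zero    v<1 _ = ⊥-elim (<⇒≱ v<1 (≤-trans (s≤s z≤n) 2≤v))
    above (suc i) v<2+i 2+i≤k =
      i , <-trans (n<1+n i) 2+i≤k ,
      trans (magnitude-skip 2+i≤k) (trans (cong (suc i +_) (passed-≥ (≤-pred v<2+i))) (+-comm (suc i) 1))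

  -- only the second to last step can differ from its magnitude, and then k + 1 ≡ −k
  step-signed : ∀ {i} → i < k → step i ≡ magnitude i ⊎ step i ≡ m ∸ magnitude i
  step-signed {i} i<k with suc (suc i) ≟ k
  ... | no 2+i≢k  = inj₁ (trans (cong (magnitude i +_) (δ-at-≢ 2+i≢k)) (+-identityʳ _))
  ... | yes 2+i≡k = by-δ δ≤1
    where
    magnitude≡k : magnitude i ≡ k
    magnitude≡k = begin
      magnitude i             ≡⟨ magnitude-skip (subst (suc i <_) 2+i≡k ≤-refl) ⟩
      suc i + passed (suc i)  ≡⟨ cong (suc i +_) (passed-≥ (≤-pred (subst (v <_) (sym 2+i≡k) v<k))) ⟩
      suc i + 1               ≡⟨ +-comm (suc i) 1 ⟩
      suc (suc i)             ≡⟨ 2+i≡k ⟩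
      k                       ∎
      where open ≡-Reasoning
    step≡k+δ : step i ≡ k + δ
    step≡k+δ = cong₂ _+_ magnitude≡k (trans (cong δ-at 2+i≡k) δ-at-k)
    by-δ : δ ≤ 1 → step i ≡ magnitude i ⊎ step i ≡ m ∸ magnitude i
    by-δ z≤n       = inj₁ (trans step≡k+δ (trans (+-identityʳ k) (sym magnitude≡k)))
    by-δ (s≤s z≤n) =
      inj₂ (trans step≡k+δ (trans (+-comm k 1) (sym (trans (cong (m ∸_) magnitude≡k) m∸k≡1+k))))

  γ-signed : ∀ {i} → i < k → γ i ≡ magnitude i ⊎ γ i ≡ m ∸ magnitude i
  γ-signed {i} i<k with signed-cases i (step i) | step-signed i<k
  ... | inj₁ γ≡step   | inj₁ step≡C   = inj₁ (trans γ≡step step≡C)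
  ... | inj₁ γ≡step   | inj₂ step≡m∸C = inj₂ (trans γ≡step step≡m∸C)
  ... | inj₂ γ≡m∸step | inj₁ step≡C   = inj₂ (trans γ≡m∸step (cong (m ∸_) step≡C))
  ... | inj₂ γ≡m∸step | inj₂ step≡m∸C =
    inj₁ (trans γ≡m∸step (trans (cong (m ∸_) step≡m∸C)
                                (m∸[m∸n]≡n (≤-trans (proj₂ (magnitude-range i<k)) k≤m))))

  simpleZeroSumHalfSet : SimpleZeroSumHalfSet k γ
  simpleZeroSumHalfSet = record
    { γ-range             = γ-range
    ; γ-injective         = γ-injective
    ; γ-covers            = γ-covers
    ; sum≡0               = prefixSum-total
    ; prefixSum-injective = prefixSum-injective
    }
    where
    open SignedMagnitudes magnitude γ magnitude-range magnitude-injective magnitude-surjective γ-signed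

-- Coefficients for k = j + 2 diagonals.
module BalancedCoefficients (p j : ℕ) .{{_ : NonZero p}} (j<p : j < p) where

  μ : ℕ
  μ = p ∸ j

  multiplier : ℕ → ℕ
  multiplier zero    = μ
  multiplier (suc D) = if does (D ≟ j) then μ else 2

  multiplier-middle : ∀ {D} → D < j → multiplier (suc D) ≡ 2
  multiplier-middle {D} D<j rewrite dec-false (D ≟ j) (<⇒≢ D<j) = refl

  multiplier-last : multiplier (suc j) ≡ μ
  multiplier-last rewrite dec-true (j ≟ j) refl = refl

  μ+j≡p : μ + j ≡ p
  μ+j≡p = m∸n+n≡m (<⇒≤ j<p)

  multiplier-unit : 0 < j → 2 < p → ∀ D → 0 < multiplier D × multiplier D < p
  multiplier-unit 0<j 2<p zero    = m<n⇒0<n∸m j<p , ∸-monoʳ-< 0<j (<⇒≤ j<p)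
  multiplier-unit 0<j 2<p (suc D) with does (D ≟ j)
  ... | true  = m<n⇒0<n∸m j<p , ∸-monoʳ-< 0<j (<⇒≤ j<p)
  ... | false = s≤s z≤n , 2<p

  ∑-multiplier : ∑< (suc (suc j)) multiplier ≡ 2 * p
  ∑-multiplier = begin
    multiplier (suc j) + ∑< (suc j) multiplier   ≡⟨ cong₂ _+_ multiplier-last (initial j ≤-refl) ⟩
    μ + (μ + 2 * j)                              ≡⟨ regroup μ j ⟩
    2 * (μ + j)                                  ≡⟨ cong (2 *_) μ+j≡p ⟩
    2 * p                                        ∎
    where
    open ≡-Reasoning
    regroup : ∀ μ j → μ + (μ + 2 * j) ≡ 2 * (μ + j)
    regroup = solve-∀
    initial : ∀ n → n ≤ j → ∑< (suc n) multiplier ≡ μ + 2 * n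
    initial zero    _     = refl
    initial (suc n) 1+n≤j =
      trans (cong₂ _+_ (multiplier-middle 1+n≤j) (initial n (<⇒≤ 1+n≤j))) (shift μ n)
      where
      shift : ∀ μ n → 2 + (μ + 2 * n) ≡ μ + 2 * suc n
      shift = solve-∀

  ∑-weighted-multiplier : ∑< (suc (suc j)) (λ D → multiplier D * D) ≡ suc j * p
  ∑-weighted-multiplier = begin
    multiplier (suc j) * suc j + ∑< (suc j) (λ D → multiplier D * D)
      ≡⟨ cong₂ _+_ (cong (_* suc j) multiplier-last) (initial j ≤-refl) ⟩
    μ * suc j + j * suc j
      ≡⟨ regroup μ j ⟩
    suc j * (μ + j)
      ≡⟨ cong (suc j *_) μ+j≡p ⟩
    suc j * p ∎
    where
    open ≡-Reasoning
    regroup : ∀ μ j → μ * suc j + j * suc j ≡ suc j * (μ + j)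
    regroup = solve-∀
    initial : ∀ n → n ≤ j → ∑< (suc n) (λ D → multiplier D * D) ≡ n * suc n
    initial zero    _     = trans (+-identityʳ (μ * 0)) (*-zeroʳ μ)
    initial (suc n) 1+n≤j =
      trans (cong₂ _+_ (cong (_* suc n) (multiplier-middle 1+n≤j)) (initial n (<⇒≤ 1+n≤j))) (shift n)
      where
      shift : ∀ n → 2 * suc n + n * suc n ≡ suc n * suc (suc n)
      shift = solve-∀

  offset : ℕ → ℕ → ℕ
  offset N zero    = Modulo.negate p N
  offset N (suc _) = 0

  p∣N+∑offset : ∀ N n → p ∣ N + ∑< (suc n) (offset N)
  p∣N+∑offset N n = m%n≡0⇒n∣m _ p (begin
    (N + ∑< (suc n) (offset N)) % p    ≡⟨ cong (λ x → (N + x) % p) (∑-offset n) ⟩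
    (N + Modulo.negate p N) % p        ≡⟨ cong (_% p) (+-comm N _) ⟩
    (Modulo.negate p N + N) % p        ≡⟨ Modulo.negate-inverseˡ p N ⟩
    0 % p                              ≡⟨ Modulo.0%n≡0 p ⟩
    0                                  ∎)
    where
    open ≡-Reasoning
    ∑-offset : ∀ n → ∑< (suc n) (offset N) ≡ Modulo.negate p N
    ∑-offset zero    = +-identityʳ _
    ∑-offset (suc n) = ∑-offset n

theorem4p4 : (p k : ℕ) → Prime p → 3 ≤ p → 3 ≤ k → k ≤ p →
    Σ (Array p) λ A →
      IsHeffter p k p A × GloballySimple (HeffterW p k p) A × CyclicallyKDiagonal p k A
theorem4p4 p (suc (suc j)) p-prime 3≤p 3≤k@(s≤s (s≤s 1≤j)) k≤p =
  array , isHeffter , globallySimple , cyclicallyKDiagonal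
  where
  instance
    p-nonZero : NonZero p
    p-nonZero = prime⇒nonZero p-prime
  k : ℕ
  k = suc (suc j)
  open SequenceShape (sequenceShape k 3≤k)
  open AlternatingSequence {g = g} k-shape v≡ δ≤1 1≤h v<k using (γ; simpleZeroSumHalfSet)
  open BalancedCoefficients p j (<-trans (n<1+n j) k≤p)
  N : ℕ
  N = ∑< k γ / suc (k + k)
  open DiagonalHeffter p k p-prime k≤p simpleZeroSumHalfSet multiplier (offset N)
    (λ {D} _ → multiplier-unit 1≤j 3≤p D) (divides 2 ∑-multiplier)
    (divides (suc j) ∑-weighted-multiplier) (p∣N+∑offset N (suc j))
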